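{- Let $(W,S)$ be a dihedral Coxeter system of order $4m$ with $m\ge 1$, i.e. $S=\{s,t\}$ and $st$ has order $2m$. If $A=\{s,t,sts\}$ or $A=\{t,sts\}$, then $\mathcal{D}_A(W)$ is a subalgebra of $\mathbb{Z}W$.
   Context: $\ell$ is the length function of $(W,S)$ and $T=\{wsw^{ -1}\mid w\in W, s\in S\}$ is the set of reflections. For $A\subseteq T$ and $w\in W$, $D_A(w)=\{r\in A\mid \ell(wr)<\ell(w)\}$. A subset $I\subseteq A$ is $A$-admissible if $I=D_A(w)$ for some $w\in W$; $\mathcal{P}_{\mathrm{ad}}(A)$ denotes the set of these. For $I\in\mathcal{P}_{\mathrm{ad}}(A)$ let $D_I^A=\{w\in W\mid D_A(w)=I\}$, $d_I^A=\sum_{w\in D_I^A}w$, and $\mathcal{D}_A(W)=\bigoplus_{I\in\mathcal{P}_{\mathrm{ad}}(A)}\mathbb{Z}d_I^A\subseteq\mathbb{Z}W$. A subalgebra need not contain $1$. -}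

module Defs where

open import Data.Nat using (ℕ; zero; suc; _+_; _*_; _∸_; _<ᵇ_)
open import Data.Nat.DivMod using (_mod_)
open import Data.Fin using (Fin; toℕ)
import Data.Fin.Properties as FinP
open import Data.Bool using (Bool; true; false; if_then_else_; not; _xor_; _∧_)
import Data.Bool.Properties as BoolP
open import Data.Integer as ℤ using (ℤ)
open import Data.Bool.ListAction using (any)
open import Data.List using (List; []; _∷_; map; concatMap; foldr; allFin; cartesianProduct; length)
open import Data.Product using (_×_; _,_; proj₁; proj₂; ∃)
open import Data.Product.Properties using (≡-dec)
open import Relation.Binary.PropositionalEquality using (_≡_)
open import Relation.Nullary.Decidable using (⌊_⌋; Dec)

-- Concretely W = {ρ^a s^b}, with ρ of order 2m, s² = 1, s ρ s = ρ⁻¹;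
-- an element is a pair (a , b) : Fin (2m) × Bool  meaning ρ^a s^b.

module Dihedral (k : ℕ) where

  m : ℕ
  m = suc k

  n : ℕ
  n = 2 * m

  W : Set
  W = Fin n × Bool

  _≟W_ : (x y : W) → Dec (x ≡ y)
  _≟W_ = ≡-dec FinP._≟_ BoolP._≟_

  e : W
  e = (0 mod n , false)

  -- (ρ^a s^b)(ρ^c s^d) = ρ^(a ± c) s^(b xor d)
  infixl 7 _·_
  _·_ : W → W → W
  (a , b) · (c , d) =
    ((toℕ a + (if b then (n ∸ toℕ c) else toℕ c)) mod n , b xor d)

  -- generators: s = ρ⁰ s,  t = ρ¹ s   (so st = ρ⁻¹ has order 2m)
  s t : W
  s = (0 mod n , true)
  t = (1 mod n , true)

  _⁻¹ : W → W
  (a , false) ⁻¹ = ((n ∸ toℕ a) mod n , false)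
  (a , true)  ⁻¹ = (a , true)

  data Gen : Set where
    gs gt : Gen

  gen : Gen → W
  gen gs = s
  gen gt = t

  eval : List Gen → W
  eval = foldr (λ g w → gen g · w) e

  words : ℕ → List (List Gen)
  words zero    = [] ∷ []
  words (suc j) = concatMap (λ u → (gs ∷ u) ∷ (gt ∷ u) ∷ []) (words j)

  search : W → (fuel j : ℕ) → ℕ
  search w zero     j = j
  search w (suc f) j =
    if any (λ u → ⌊ eval u ≟W w ⌋) (words j) then j else search w f (suc j)

  -- Every element of W has a word of length < |W| = 4m, so the fuel 4m
  -- suffices and this is the Coxeter length.
  ℓ : W → ℕ
  ℓ w = search w (4 * m) 0

  isDescent : W → W → Bool
  isDescent w r = ℓ (w · r) <ᵇ ℓ w

  sameDescent : List W → W → W → Bool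
  sameDescent A u w =
    foldr _∧_ true (map (λ r → not (isDescent u r xor isDescent w r)) A)

  ℤW : Set
  ℤW = W → ℤ

  elems : List W
  elems = cartesianProduct (allFin n) (true ∷ false ∷ [])

  sumW : (W → ℤ) → ℤ
  sumW f = foldr (λ w acc → f w ℤ.+ acc) (ℤ.+ 0) elems

  _*W_ : ℤW → ℤW → ℤW
  (x *W y) w = sumW (λ u → x u ℤ.* y (u ⁻¹ · w))

  _≈W_ : ℤW → ℤW → Set
  x ≈W y = ∀ w → x w ≡ y w

  -- d^A_I for the admissible set I = D_A(w):  sum of all u with D_A(u) = I
  d : List W → W → ℤW
  d A w u = if sameDescent A u w then ℤ.+ 1 else ℤ.+ 0

  -- 𝒟_A(W) = ℤ-span of { d^A_I | I ∈ P_ad(A) } = span of { d^A_{D_A(w)} | w ∈ W }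
  InDescentAlg : List W → ℤW → Set
  InDescentAlg A x =
    ∃ λ (L : List (ℤ × W)) →
      x ≈W (λ u → foldr (λ cw acc → proj₁ cw ℤ.* d A (proj₂ cw) u ℤ.+ acc) (ℤ.+ 0) L)

  -- "𝒟_A(W) is a (not necessarily unital) subalgebra of ℤW":
  -- it is a ℤ-submodule by definition; closure under multiplication:
  IsSubalgebra : List W → Set
  IsSubalgebra A = ∀ x y → InDescentAlg A x → InDescentAlg A y → InDescentAlg A (x *W y)

  A₁ A₂ : List W
  A₁ = s ∷ t ∷ (s · t · s) ∷ []
  A₂ = t ∷ (s · t · s) ∷ []

{-# OPTIONS --safe #-}
module Submission where

-- Write w₀ = ρ^m for the central longest element (ρ = ts). The A₁-descent classes are {e}, {s},
-- {w₀}, {w₀s} and two further classes X ∋ t and Y ∋ ts; for A₂ the pairs {e, s} and {w₀, w₀s}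
-- merge. Lengths are explicit (ρ^a = (ts)^a has length 2 min(a, 2m - a)), so descent sets, and
-- hence the classes, can be read off, and 𝒟_A(W) is the space of functions W → ℤ constant on
-- classes. To see that the convolution x ⋆ y is again such a function, subtract multiples of e
-- and w₀ from y to obtain y₂, constant on the merged classes and therefore invariant under s · _.
-- Then 2 (x ⋆ y₂) = (x + x(_ · s)) ⋆ y₂, and x + x(_ · s) is constant off {e, s, w₀, w₀s} because
-- _ · s swaps X and Y. This expresses 2 (x ⋆ y)(u) through ∑ y₂, y₂(u), y₂(w₀u), x(u) and
-- x(uw₀), all constant on classes since multiplication by w₀ permutes them.

open import Defs
open import Algebra.Bundles using (Group)
open import Algebra.Structures using (IsGroup)
import Algebra.Properties.Group as GroupProperties
open import Data.Bool using (Bool; true; false; if_then_else_; not; T; _xor_; _∧_)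
import Data.Bool.Properties as BoolP
open import Data.Bool.ListAction using (any)
open import Data.Empty using (⊥-elim)
open import Data.Fin using (Fin; toℕ)
import Data.Fin.Properties as FinP
open import Data.Integer as ℤ using (ℤ; 0ℤ; 1ℤ)
import Data.Integer.Properties as ℤP
open import Data.Integer.Solver using (module +-*-Solver)
open import Data.List using (List; []; _∷_; foldr; map; length)
import Data.List.Properties as ListP
open import Data.List.Membership.Propositional using (_∈_)
import Data.List.Membership.Propositional.Properties as MembershipP
open import Data.List.Relation.Unary.All as All using (All; []; _∷_)
import Data.List.Relation.Unary.All.Properties as AllP
import Data.List.Relation.Unary.AllPairs as AllPairs
open import Data.List.Relation.Unary.Any as Any using (here; there)
import Data.List.Relation.Unary.Any.Properties as AnyP
open import Data.List.Relation.Unary.Unique.Propositional using (Unique)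
import Data.List.Relation.Unary.Unique.Propositional.Properties as UniqueP
open import Data.Nat using (ℕ; zero; suc; z≤n; s≤s; z<s; NonZero; >-nonZero⁻¹)
import Data.Nat.Properties as ℕP
open import Data.Nat.DivMod
  using (_mod_; m%n%n≡m%n; m<n⇒m%n≡m; n%n≡0; %-distribˡ-+; [m+n]%n≡m%n; m%n<n)
open import Data.Product using (_×_; _,_; proj₁; proj₂; ∃)
open import Data.Sum using (_⊎_; inj₁; inj₂)
open import Function using (_∘_; id; _⇔_; mk⇔; Equivalence)
open import Level using (0ℓ)
open import Relation.Binary.Bundles using (Setoid)
import Relation.Binary.Reasoning.Setoid as SetoidReasoning
open import Relation.Binary.Definitions using (DecidableEquality; tri<; tri≈; tri>)
open import Relation.Binary.PropositionalEquality
open import Relation.Binary.PropositionalEquality.Algebra using (isMagma)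
open import Relation.Nullary using (¬_; Dec; yes; no; contradiction)
open import Relation.Nullary.Decidable using (⌊_⌋; fromWitness; toWitness)
open import Algebra.Properties.CommutativeSemigroup ℕP.+-commutativeSemigroup
  using () renaming (interchange to +-interchange)

open +-*-Solver using (solve; _:+_; _:*_; _:-_; _:=_; con)

¬T⇒≡false : ∀ {b} → ¬ T b → b ≡ false
¬T⇒≡false {false} _  = refl
¬T⇒≡false {true}  ¬t = contradiction _ ¬t

module _ {a} {X : Set a} where

  all-agree⇔map≡ : ∀ (f g : X → Bool) rs →
    foldr _∧_ true (map (λ r → not (f r xor g r)) rs) ≡ true ⇔ map f rs ≡ map g rs
  all-agree⇔map≡ f g rs = mk⇔ (to rs) (from rs)
    where
    not-xor : ∀ a b → not (a xor b) ≡ true → a ≡ b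
    not-xor false false _ = refl
    not-xor true  true  _ = refl
    to : ∀ rs → foldr _∧_ true (map (λ r → not (f r xor g r)) rs) ≡ true → map f rs ≡ map g rs
    to []       _         = refl
    to (r ∷ rs) all-agree with not (f r xor g r) in agree
    ... | true = cong₂ _∷_ (not-xor (f r) (g r) agree) (to rs all-agree)
    from : ∀ rs → map f rs ≡ map g rs → foldr _∧_ true (map (λ r → not (f r xor g r)) rs) ≡ true
    from []       _     = refl
    from (r ∷ rs) fs≡gs with ListP.∷-injective fs≡gs
    ... | fr≡gr , rest rewrite fr≡gr | BoolP.xor-same (g r) = from rs rest

module _ {a} {A : Set a} where

  open import Data.Integer using (_+_; _*_)

  sumBy : (A → ℤ) → List A → ℤ
  sumBy f []       = 0ℤ
  sumBy f (x ∷ xs) = f x + sumBy f xs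

  foldr≡sumBy : ∀ (f : A → ℤ) xs → foldr (λ x acc → f x + acc) 0ℤ xs ≡ sumBy f xs
  foldr≡sumBy f []       = refl
  foldr≡sumBy f (x ∷ xs) = cong (f x +_) (foldr≡sumBy f xs)

  sumBy-cong : ∀ {f g : A → ℤ} xs → (∀ x → f x ≡ g x) → sumBy f xs ≡ sumBy g xs
  sumBy-cong []       f≗g = refl
  sumBy-cong (x ∷ xs) f≗g = cong₂ _+_ (f≗g x) (sumBy-cong xs f≗g)

  sumBy-zero : ∀ xs → sumBy (λ _ → 0ℤ) xs ≡ 0ℤ
  sumBy-zero []       = refl
  sumBy-zero (x ∷ xs) = trans (ℤP.+-identityˡ _) (sumBy-zero xs)

  sumBy-+ : ∀ (f g : A → ℤ) xs → sumBy (λ x → f x + g x) xs ≡ sumBy f xs + sumBy g xs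
  sumBy-+ f g []       = refl
  sumBy-+ f g (x ∷ xs) rewrite sumBy-+ f g xs =
    solve 4 (λ a b c d → (a :+ b) :+ (c :+ d) := (a :+ c) :+ (b :+ d)) refl
      (f x) (g x) (sumBy f xs) (sumBy g xs)

  sumBy-*ˡ : ∀ c (f : A → ℤ) xs → sumBy (λ x → c * f x) xs ≡ c * sumBy f xs
  sumBy-*ˡ c f []       = sym (ℤP.*-zeroʳ c)
  sumBy-*ˡ c f (x ∷ xs) rewrite sumBy-*ˡ c f xs = sym (ℤP.*-distribˡ-+ c (f x) (sumBy f xs))

  sumBy-swap : ∀ (F : A → A → ℤ) xs ys →
    sumBy (λ x → sumBy (F x) ys) xs ≡ sumBy (λ y → sumBy (λ x → F x y) xs) ys
  sumBy-swap F []       ys = sym (sumBy-zero ys)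
  sumBy-swap F (x ∷ xs) ys rewrite sumBy-swap F xs ys =
    sym (sumBy-+ (F x) (λ y → sumBy (λ x → F x y) xs) ys)

module Kronecker {a} {A : Set a} (_≟_ : DecidableEquality A) where

  open import Data.Integer using (_+_; _*_)

  δ : A → A → ℤ
  δ x y = if ⌊ x ≟ y ⌋ then 1ℤ else 0ℤ

  δ-diag : ∀ x → δ x x ≡ 1ℤ
  δ-diag x with x ≟ x
  ... | yes _  = refl
  ... | no x≢x = contradiction refl x≢x

  δ-off : ∀ {x y} → x ≢ y → δ x y ≡ 0ℤ
  δ-off {x} {y} x≢y with x ≟ y
  ... | yes x≡y = contradiction x≡y x≢y
  ... | no _    = refl

  δ-cong-⇔ : ∀ {x y x′ y′} → (x ≡ y → x′ ≡ y′) → (x′ ≡ y′ → x ≡ y) → δ x y ≡ δ x′ y′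
  δ-cong-⇔ {x} {y} {x′} {y′} to from with x ≟ y | x′ ≟ y′
  ... | yes _   | yes _     = refl
  ... | no _    | no _      = refl
  ... | yes x≡y | no x′≢y′  = contradiction (to x≡y) x′≢y′
  ... | no x≢y  | yes x′≡y′ = contradiction (from x′≡y′) x≢y

  sumBy-δ-absent : ∀ {x} (f : A → ℤ) xs → All (x ≢_) xs → sumBy (λ y → δ x y * f y) xs ≡ 0ℤ
  sumBy-δ-absent f []       []           = refl
  sumBy-δ-absent f (y ∷ xs) (x≢y ∷ x∉xs) =
    cong₂ _+_ (trans (cong (_* f y) (δ-off x≢y)) (ℤP.*-zeroˡ (f y))) (sumBy-δ-absent f xs x∉xs)

  sumBy-δ : ∀ {x} (f : A → ℤ) xs → Unique xs → x ∈ xs → sumBy (λ y → δ x y * f y) xs ≡ f x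
  sumBy-δ f (y ∷ xs) (y∉xs AllPairs.∷ _) (here refl) = begin
    δ y y * f y + sumBy (λ z → δ y z * f z) xs
      ≡⟨ cong₂ _+_ (cong (_* f y) (δ-diag y)) (sumBy-δ-absent f xs y∉xs) ⟩
    1ℤ * f y + 0ℤ
      ≡⟨ trans (ℤP.+-identityʳ _) (ℤP.*-identityˡ (f y)) ⟩
    f y ∎
    where open ≡-Reasoning
  sumBy-δ {x} f (y ∷ xs) (y∉xs AllPairs.∷ xs-unique) (there x∈xs) = begin
    δ x y * f y + sumBy (λ z → δ x z * f z) xs
      ≡⟨ cong₂ _+_ (cong (_* f y) (δ-off x≢y)) (sumBy-δ f xs xs-unique x∈xs) ⟩
    0ℤ * f y + f x
      ≡⟨ ℤP.+-identityˡ (f x) ⟩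
    f x ∎
    where
    open ≡-Reasoning
    x≢y : x ≢ y
    x≢y x≡y = All.lookup y∉xs (subst (_∈ xs) x≡y x∈xs) refl

module GroupAlgebra
  {G : Set} {_∙_ : G → G → G} {ε : G} {_⁻¹ : G → G}
  (isGroup : IsGroup _≡_ _∙_ ε _⁻¹) (_≟_ : DecidableEquality G)
  {elements : List G} (elements-unique : Unique elements)
  (elements-complete : ∀ g → g ∈ elements)
  where

  group : Group 0ℓ 0ℓ
  group = record { isGroup = isGroup }

  open Kronecker _≟_ public using (δ; δ-diag; δ-off)
  open Kronecker _≟_ using (sumBy-δ; δ-cong-⇔)
  open Group group public using (_\\_; _//_)
  open GroupProperties group using
    ( \\-leftDividesˡ; //-rightDividesˡ; //-rightDividesʳ; x≈z//y; y≈x\\z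
    ; ⁻¹-anti-homo-\\; ⁻¹-anti-homo-//; ⁻¹-anti-homo-∙ )
  open IsGroup isGroup using (assoc)
  open import Data.Integer using (_+_; _*_)

  ∑ : (G → ℤ) → ℤ
  ∑ f = sumBy f elements

  ∑-cong : ∀ {f g : G → ℤ} → (∀ h → f h ≡ g h) → ∑ f ≡ ∑ g
  ∑-cong = sumBy-cong elements

  ∑-δ : ∀ g (f : G → ℤ) → ∑ (λ h → δ g h * f h) ≡ f g
  ∑-δ g f = sumBy-δ f elements elements-unique (elements-complete g)

  ∑-reindex : (π π⁻ : G → G) → (∀ g → π⁻ (π g) ≡ g) → (∀ g → π (π⁻ g) ≡ g) →
              ∀ (f : G → ℤ) → ∑ (f ∘ π) ≡ ∑ f
  ∑-reindex π π⁻ π⁻∘π π∘π⁻ f = begin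
    ∑ (f ∘ π)                              ≡⟨ ∑-cong (λ g → sym (∑-δ (π g) f)) ⟩
    ∑ (λ g → ∑ (λ h → δ (π g) h * f h))   ≡⟨ sumBy-swap (λ g h → δ (π g) h * f h) elements elements ⟩
    ∑ (λ h → ∑ (λ g → δ (π g) h * f h))   ≡⟨ ∑-cong (λ h → ∑-cong (λ g → cong (_* f h) (δ-π g h))) ⟩
    ∑ (λ h → ∑ (λ g → δ (π⁻ h) g * f h))  ≡⟨ ∑-cong (λ h → ∑-δ (π⁻ h) (λ _ → f h)) ⟩
    ∑ f                                    ∎
    where
    open ≡-Reasoning
    δ-π : ∀ g h → δ (π g) h ≡ δ (π⁻ h) g
    δ-π g h = δ-cong-⇔ (λ πg≡h → trans (cong π⁻ (sym πg≡h)) (π⁻∘π g))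
                       (λ π⁻h≡g → trans (cong π (sym π⁻h≡g)) (π∘π⁻ h))

  \\-∙ : ∀ h g u → (h ∙ g) \\ u ≡ g \\ (h \\ u)
  \\-∙ h g u = trans (cong (_∙ u) (⁻¹-anti-homo-∙ h g)) (assoc (g ⁻¹) (h ⁻¹) u)

  \\-invariant : ∀ {y : G → ℤ} g → (∀ h → y (g ∙ h) ≡ y h) → ∀ h → y (g \\ h) ≡ y h
  \\-invariant {y} g y-invariant h = trans (sym (y-invariant (g \\ h))) (cong y (\\-leftDividesˡ g h))

  infixl 7 _⋆_
  _⋆_ : (G → ℤ) → (G → ℤ) → G → ℤ
  (x ⋆ y) g = ∑ (λ h → x h * y (h \\ g))

  ⋆-congˡ : ∀ {x x′} y → (∀ g → x g ≡ x′ g) → ∀ u → (x ⋆ y) u ≡ (x′ ⋆ y) u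
  ⋆-congˡ y x≗x′ u = ∑-cong (λ h → cong (_* y (h \\ u)) (x≗x′ h))

  ⋆-congʳ : ∀ x {y y′} → (∀ g → y g ≡ y′ g) → ∀ u → (x ⋆ y) u ≡ (x ⋆ y′) u
  ⋆-congʳ x y≗y′ u = ∑-cong (λ h → cong (x h *_) (y≗y′ (h \\ u)))

  ⋆-distribʳ-+ : ∀ x x′ y u → ((λ g → x g + x′ g) ⋆ y) u ≡ (x ⋆ y) u + (x′ ⋆ y) u
  ⋆-distribʳ-+ x x′ y u =
    trans (∑-cong (λ h → ℤP.*-distribʳ-+ (y (h \\ u)) (x h) (x′ h))) (sumBy-+ _ _ elements)

  ⋆-distribˡ-+ : ∀ x y y′ u → (x ⋆ (λ g → y g + y′ g)) u ≡ (x ⋆ y) u + (x ⋆ y′) u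
  ⋆-distribˡ-+ x y y′ u =
    trans (∑-cong (λ h → ℤP.*-distribˡ-+ (x h) (y (h \\ u)) (y′ (h \\ u)))) (sumBy-+ _ _ elements)

  ⋆-*ˡ : ∀ c x y u → ((λ g → c * x g) ⋆ y) u ≡ c * (x ⋆ y) u
  ⋆-*ˡ c x y u = trans (∑-cong (λ h → ℤP.*-assoc c (x h) (y (h \\ u)))) (sumBy-*ˡ c _ elements)

  ⋆-*ʳ : ∀ c x y u → (x ⋆ (λ g → c * y g)) u ≡ c * (x ⋆ y) u
  ⋆-*ʳ c x y u = trans (∑-cong (λ h → *-comm-middle (x h) (y (h \\ u)))) (sumBy-*ˡ c _ elements)
    where
    *-comm-middle : ∀ a b → a * (c * b) ≡ c * (a * b)
    *-comm-middle a b = solve 3 (λ a b c → a :* (c :* b) := c :* (a :* b)) refl a b c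

  ⋆-δˡ : ∀ g y u → (δ g ⋆ y) u ≡ y (g \\ u)
  ⋆-δˡ g y u = ∑-δ g (λ h → y (h \\ u))

  ⋆-δʳ : ∀ x g u → (x ⋆ δ g) u ≡ x (u // g)
  ⋆-δʳ x g u = trans (∑-cong (λ h → trans (ℤP.*-comm (x h) _) (cong (_* x h) (δ-solve h))))
                     (∑-δ (u // g) x)
    where
    δ-solve : ∀ h → δ g (h \\ u) ≡ δ (u // g) h
    δ-solve h = δ-cong-⇔
      (λ g≡h\\u → sym (x≈z//y h g u (trans (cong (h ∙_) g≡h\\u) (\\-leftDividesˡ h u))))
      (λ u//g≡h → y≈x\\z h g u (trans (cong (_∙ g) (sym u//g≡h)) (//-rightDividesˡ g u)))

  ⋆-constˡ : ∀ c y u → ((λ _ → c) ⋆ y) u ≡ c * ∑ y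
  ⋆-constˡ c y u =
    trans (sumBy-*ˡ c _ elements) (cong (c *_) (∑-reindex (_\\ u) (u //_) left right y))
    where
    left : ∀ h → u // (h \\ u) ≡ h
    left h = trans (cong (u ∙_) (⁻¹-anti-homo-\\ h u)) (\\-leftDividesˡ u h)
    right : ∀ h → (u // h) \\ u ≡ h
    right h = trans (cong (_∙ u) (⁻¹-anti-homo-// u h)) (//-rightDividesˡ u h)

  ⋆-shift : ∀ x {y} g → (∀ h → y (g ∙ h) ≡ y h) → ∀ u → (x ⋆ y) u ≡ ((λ h → x (h ∙ g)) ⋆ y) u
  ⋆-shift x {y} g y-invariant u = begin
    ∑ (λ h → x h * y (h \\ u))
      ≡⟨ ∑-reindex (_∙ g) (_// g) (//-rightDividesʳ g) (//-rightDividesˡ g) _ ⟨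
    ∑ (λ h → x (h ∙ g) * y ((h ∙ g) \\ u))
      ≡⟨ ∑-cong (λ h → cong (λ v → x (h ∙ g) * y v) (\\-∙ h g u)) ⟩
    ∑ (λ h → x (h ∙ g) * y (g \\ (h \\ u)))
      ≡⟨ ∑-cong (λ h → cong (x (h ∙ g) *_) (\\-invariant g y-invariant (h \\ u))) ⟩
    ∑ (λ h → x (h ∙ g) * y (h \\ u))
      ∎
    where open ≡-Reasoning

  twice : ∀ a → ℤ.+ 2 * a ≡ a + a
  twice = solve 1 (λ a → con (ℤ.+ 2) :* a := a :+ a) refl

  ⋆-δ-pair : ∀ h {y} g → (∀ v → y (g ∙ v) ≡ y v) → ∀ u →
             ((λ v → δ h v + δ (h ∙ g) v) ⋆ y) u ≡ ℤ.+ 2 * y (h \\ u)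
  ⋆-δ-pair h {y} g y-invariant u = begin
    ((λ v → δ h v + δ (h ∙ g) v) ⋆ y) u  ≡⟨ ⋆-distribʳ-+ (δ h) (δ (h ∙ g)) y u ⟩
    (δ h ⋆ y) u + (δ (h ∙ g) ⋆ y) u      ≡⟨ cong₂ _+_ (⋆-δˡ h y u) (⋆-δˡ (h ∙ g) y u) ⟩
    y (h \\ u) + y ((h ∙ g) \\ u)        ≡⟨ cong (λ v → y (h \\ u) + y v) (\\-∙ h g u) ⟩
    y (h \\ u) + y (g \\ (h \\ u))       ≡⟨ cong (y (h \\ u) +_) (\\-invariant g y-invariant (h \\ u)) ⟩
    y (h \\ u) + y (h \\ u)              ≡⟨ twice (y (h \\ u)) ⟨
    ℤ.+ 2 * y (h \\ u)                   ∎
    where open ≡-Reasoning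

module Modulo (n : ℕ) .{{_ : NonZero n}} where
  open import Data.Nat using (_+_; _∸_; _%_)

  infix 4 _≋_
  data _≋_ (x y : ℕ) : Set where
    mk≋ : x % n ≡ y % n → x ≋ y

  ≋-refl : ∀ {x} → x ≋ x
  ≋-refl = mk≋ refl

  ≋-sym : ∀ {x y} → x ≋ y → y ≋ x
  ≋-sym (mk≋ p) = mk≋ (sym p)

  ≋-trans : ∀ {x y z} → x ≋ y → y ≋ z → x ≋ z
  ≋-trans (mk≋ p) (mk≋ q) = mk≋ (trans p q)

  ≡⇒≋ : ∀ {x y} → x ≡ y → x ≋ y
  ≡⇒≋ refl = ≋-refl

  ≋-setoid : Setoid 0ℓ 0ℓ
  ≋-setoid = record
    { Carrier       = ℕ
    ; _≈_           = _≋_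
    ; isEquivalence = record { refl = ≋-refl ; sym = ≋-sym ; trans = ≋-trans }
    }

  module ≋-Reasoning = SetoidReasoning ≋-setoid

  ≋-+ : ∀ {a a′ b b′} → a ≋ a′ → b ≋ b′ → a + b ≋ a′ + b′
  ≋-+ {a} {a′} {b} {b′} (mk≋ p) (mk≋ q) = mk≋ (begin
    (a + b) % n             ≡⟨ %-distribˡ-+ a b n ⟩
    (a % n + b % n) % n     ≡⟨ cong₂ (λ u v → (u + v) % n) p q ⟩
    (a′ % n + b′ % n) % n   ≡⟨ %-distribˡ-+ a′ b′ n ⟨
    (a′ + b′) % n           ∎)
    where open ≡-Reasoning

  %-≋ : ∀ x → x % n ≋ x
  %-≋ x = mk≋ (m%n%n≡m%n x n)

  n≋0 : n ≋ 0
  n≋0 = mk≋ (trans (n%n≡0 n) (sym (m<n⇒m%n≡m (>-nonZero⁻¹ n))))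

  neg : ℕ → ℕ
  neg x = n ∸ x % n

  +-neg : ∀ x → x + neg x ≋ 0
  +-neg x = begin
    x + neg x        ≈⟨ ≋-+ (≋-sym (%-≋ x)) ≋-refl ⟩
    x % n + neg x    ≡⟨ ℕP.m+[n∸m]≡n (ℕP.<⇒≤ (m%n<n x n)) ⟩
    n                ≈⟨ n≋0 ⟩
    0                ∎
    where open ≋-Reasoning

  neg-unique : ∀ {x y} → x + y ≋ 0 → y ≋ neg x
  neg-unique {x} {y} x+y≋0 = begin
    y                  ≡⟨ ℕP.+-identityʳ y ⟨
    y + 0              ≈⟨ ≋-+ (≋-refl {y}) (≋-sym (+-neg x)) ⟩
    y + (x + neg x)    ≡⟨ ℕP.+-assoc y x (neg x) ⟨
    (y + x) + neg x    ≡⟨ cong (_+ neg x) (ℕP.+-comm y x) ⟩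
    (x + y) + neg x    ≈⟨ ≋-+ x+y≋0 (≋-refl {neg x}) ⟩
    neg x              ∎
    where open ≋-Reasoning

  neg-cong : ∀ {x y} → x ≋ y → neg x ≡ neg y
  neg-cong (mk≋ p) = cong (n ∸_) p

  neg-+ : ∀ x y → neg (x + y) ≋ neg x + neg y
  neg-+ x y = ≋-sym (neg-unique {x + y} (begin
    (x + y) + (neg x + neg y)    ≡⟨ +-interchange x y (neg x) (neg y) ⟩
    (x + neg x) + (y + neg y)    ≈⟨ ≋-+ (+-neg x) (+-neg y) ⟩
    0                            ∎))
    where open ≋-Reasoning

  neg-involutive : ∀ x → neg (neg x) ≋ x
  neg-involutive x = ≋-sym (neg-unique {neg x} (≋-trans (≡⇒≋ (ℕP.+-comm (neg x) x)) (+-neg x)))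

  -- s^b ρ^c = ρ^((-1)^b c) s^b
  sign : Bool → ℕ → ℕ
  sign b x = if b then neg x else x

  sign-cong : ∀ b {x y} → x ≋ y → sign b x ≋ sign b y
  sign-cong false x≋y = x≋y
  sign-cong true  x≋y = ≡⇒≋ (neg-cong x≋y)

  sign-+ : ∀ b x y → sign b (x + y) ≋ sign b x + sign b y
  sign-+ false x y = ≋-refl
  sign-+ true  x y = neg-+ x y

  sign-xor : ∀ b c x → sign b (sign c x) ≋ sign (b xor c) x
  sign-xor false c     x = ≋-refl
  sign-xor true  false x = ≋-refl
  sign-xor true  true  x = neg-involutive x

  toℕ-mod : ∀ x → toℕ (x mod n) ≡ x % n
  toℕ-mod x = FinP.toℕ-fromℕ< (m%n<n x n)

  toℕ-mod-≋ : ∀ x → toℕ (x mod n) ≋ x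
  toℕ-mod-≋ x = ≋-trans (≡⇒≋ (toℕ-mod x)) (%-≋ x)

  toℕ-% : (a : Fin n) → toℕ a % n ≡ toℕ a
  toℕ-% a = m<n⇒m%n≡m (FinP.toℕ<n a)

  if-sign : ∀ b (a : Fin n) → (if b then n ∸ toℕ a else toℕ a) ≡ sign b (toℕ a)
  if-sign false a = refl
  if-sign true  a = cong (n ∸_) (sym (toℕ-% a))

  mod-cong : ∀ {x y} → x ≋ y → x mod n ≡ y mod n
  mod-cong {x} {y} (mk≋ p) = FinP.toℕ-injective (trans (toℕ-mod x) (trans p (sym (toℕ-mod y))))

  toℕ-mod-inverse : (a : Fin n) → toℕ a mod n ≡ a
  toℕ-mod-inverse a = FinP.toℕ-injective (trans (toℕ-mod (toℕ a)) (toℕ-% a))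

module DihedralGroup (k : ℕ) where
  open Dihedral k
  open Modulo n public
  open import Data.Nat using (_+_; _∸_)

  ·-assoc : ∀ x y z → (x · y) · z ≡ x · (y · z)
  ·-assoc (a , b) (c , d) (e′ , f) = cong₂ _,_ (mod-cong exponent) (BoolP.xor-assoc b d f)
    where
    open ≋-Reasoning
    A = toℕ a
    C = toℕ c
    E = toℕ e′
    exponent : toℕ ((A + (if b then n ∸ C else C)) mod n) + (if b xor d then n ∸ E else E)
             ≋ A + (if b then n ∸ toℕ ((C + (if d then n ∸ E else E)) mod n)
                         else toℕ ((C + (if d then n ∸ E else E)) mod n))
    exponent = begin
      toℕ ((A + (if b then n ∸ C else C)) mod n) + (if b xor d then n ∸ E else E)
        ≡⟨ cong₂ (λ u v → toℕ ((A + u) mod n) + v) (if-sign b c) (if-sign (b xor d) e′) ⟩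
      toℕ ((A + sign b C) mod n) + sign (b xor d) E
        ≈⟨ ≋-+ (toℕ-mod-≋ (A + sign b C)) (≋-sym (sign-xor b d E)) ⟩
      (A + sign b C) + sign b (sign d E)
        ≡⟨ ℕP.+-assoc A (sign b C) (sign b (sign d E)) ⟩
      A + (sign b C + sign b (sign d E))
        ≈⟨ ≋-+ (≋-refl {A}) (≋-sym (sign-+ b C (sign d E))) ⟩
      A + sign b (C + sign d E)
        ≈⟨ ≋-+ (≋-refl {A}) (sign-cong b (≋-sym (toℕ-mod-≋ (C + sign d E)))) ⟩
      A + sign b (toℕ ((C + sign d E) mod n))
        ≡⟨ cong (λ v → A + sign b (toℕ ((C + v) mod n))) (if-sign d e′) ⟨
      A + sign b (toℕ ((C + (if d then n ∸ E else E)) mod n))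
        ≡⟨ cong (A +_) (if-sign b ((C + (if d then n ∸ E else E)) mod n)) ⟨
      A + (if b then n ∸ toℕ ((C + (if d then n ∸ E else E)) mod n)
                else toℕ ((C + (if d then n ∸ E else E)) mod n)) ∎

  ·-identityˡ : ∀ x → e · x ≡ x
  ·-identityˡ (c , d) = cong (_, d) (toℕ-mod-inverse c)

  ·-identityʳ : ∀ x → x · e ≡ x
  ·-identityʳ (a , b) =
    cong₂ _,_ (trans (mod-cong (exponent b)) (toℕ-mod-inverse a)) (BoolP.xor-identityʳ b)
    where
    exponent : ∀ b → toℕ a + (if b then n ∸ 0 else 0) ≋ toℕ a
    exponent false = ≡⇒≋ (ℕP.+-identityʳ (toℕ a))
    exponent true  = ≋-trans (≋-+ (≋-refl {toℕ a}) n≋0) (≡⇒≋ (ℕP.+-identityʳ (toℕ a)))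

  ∸-+-≋0 : (a : Fin n) → (n ∸ toℕ a) + toℕ a ≋ 0
  ∸-+-≋0 a = ≋-trans (≡⇒≋ (ℕP.m∸n+n≡m (ℕP.<⇒≤ (FinP.toℕ<n a)))) n≋0

  +-∸-≋0 : (a : Fin n) → toℕ a + (n ∸ toℕ a) ≋ 0
  +-∸-≋0 a = ≋-trans (≡⇒≋ (ℕP.+-comm (toℕ a) _)) (∸-+-≋0 a)

  ·-inverseˡ : ∀ x → x ⁻¹ · x ≡ e
  ·-inverseˡ (a , false) = cong (_, false) (mod-cong
    (≋-trans (≋-+ (toℕ-mod-≋ (n ∸ toℕ a)) (≋-refl {toℕ a})) (∸-+-≋0 a)))
  ·-inverseˡ (a , true)  = cong (_, false) (mod-cong (+-∸-≋0 a))

  ·-inverseʳ : ∀ x → x · x ⁻¹ ≡ e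
  ·-inverseʳ (a , false) = cong (_, false) (mod-cong
    (≋-trans (≋-+ (≋-refl {toℕ a}) (toℕ-mod-≋ (n ∸ toℕ a))) (+-∸-≋0 a)))
  ·-inverseʳ (a , true)  = cong (_, false) (mod-cong (+-∸-≋0 a))

  ·-isGroup : IsGroup _≡_ _·_ e _⁻¹
  ·-isGroup = record
    { isMonoid = record
      { isSemigroup = record { isMagma = isMagma _·_ ; assoc = ·-assoc }
      ; identity    = ·-identityˡ , ·-identityʳ
      }
    ; inverse = ·-inverseˡ , ·-inverseʳ
    ; ⁻¹-cong = cong _⁻¹
    }

  W-group : Group 0ℓ 0ℓ
  W-group = record { isGroup = ·-isGroup }

  elems-unique : Unique elems
  elems-unique = UniqueP.cartesianProduct⁺ (UniqueP.allFin⁺ n)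
    (((λ ()) All.∷ All.[]) AllPairs.∷ (All.[] AllPairs.∷ AllPairs.[]))

  elems-complete : ∀ w → w ∈ elems
  elems-complete (a , b) = MembershipP.∈-cartesianProduct⁺ (MembershipP.∈-allFin a) (bool∈ b)
    where
    bool∈ : ∀ b → b ∈ true ∷ false ∷ []
    bool∈ true  = here refl
    bool∈ false = there (here refl)

module LengthFormulas (k : ℕ) where
  open Dihedral k
  open DihedralGroup k
  open import Data.Nat using (_+_; _*_; _∸_; _%_; _<_; _≤_; _<ᵇ_; _⊓_)

  n≡m+m : n ≡ m + m
  n≡m+m = cong (m +_) (ℕP.+-identityʳ m)

  n∸m≡m : n ∸ m ≡ m
  n∸m≡m = trans (cong (_∸ m) n≡m+m) (ℕP.m+n∸m≡n m m)

  n∸1+m≡k : n ∸ suc m ≡ k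
  n∸1+m≡k = trans (cong (_∸ suc m) n≡m+m) (ℕP.m+n∸n≡m k (suc k))

  n∸≡ : ∀ {A d} → A + d ≡ n → n ∸ A ≡ d
  n∸≡ {A} {d} A+d≡n = trans (cong (_∸ A) (sym A+d≡n)) (ℕP.m+n∸m≡n A d)

  m<n : m < n
  m<n = subst (m <_) (sym n≡m+m) (ℕP.m<m+n m z<s)

  1<n : 1 < n
  1<n = ℕP.≤-<-trans (s≤s z≤n) m<n

  ≤m⇒<n : ∀ {A} → A ≤ m → A < n
  ≤m⇒<n A≤m = ℕP.≤-<-trans A≤m m<n

  data Region : ℕ → Set where
    origin : Region 0
    lower  : ∀ {j} → j < k → Region (suc j)
    middle : Region m
    upper  : ∀ {A} d → d < k → A + suc d ≡ n → Region A

  m<upper : ∀ {A d} → d < k → A + suc d ≡ n → m < A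
  m<upper {A} {d} d<k A+1+d≡n = ℕP.+-cancelʳ-< (suc d) m A (begin-strict
    m + suc d   <⟨ ℕP.+-monoʳ-< m (s≤s d<k) ⟩
    m + m       ≡⟨ n≡m+m ⟨
    n           ≡⟨ A+1+d≡n ⟨
    A + suc d   ∎)
    where open ℕP.≤-Reasoning

  region : ∀ {A} → A < n → Region A
  region {zero}  _   = origin
  region {suc j} A<n with ℕP.<-cmp j k
  ... | tri< j<k _ _  = lower j<k
  ... | tri≈ _ refl _ = middle
  ... | tri> _ _ k<j  = upper (n ∸ suc (suc j)) d<k (trans (ℕP.+-suc (suc j) _) (ℕP.m+[n∸m]≡n A<n))
    where
    open ℕP.≤-Reasoning
    n<2+j+k : n < suc (suc j) + k
    n<2+j+k = begin-strict
      n                   ≡⟨ n≡m+m ⟩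
      suc (k + suc k)     ≡⟨ cong suc (ℕP.+-suc k k) ⟩
      suc (suc (k + k))   <⟨ s≤s (s≤s (ℕP.+-monoˡ-< k k<j)) ⟩
      suc (suc (j + k))   ∎
    d<k : n ∸ suc (suc j) < k
    d<k = ℕP.+-cancelˡ-< (suc (suc j)) _ k
            (subst (_< suc (suc j) + k) (sym (ℕP.m+[n∸m]≡n A<n)) n<2+j+k)

  -- ρ = ts, so ρ^A = (ts)^A and ρ^A s = (ts)^(A-1) t for A ≤ m, and ρ^A = (st)^(n-A) for A ≥ m
  rotationLength : ℕ → ℕ
  rotationLength A = 2 * (A ⊓ (n ∸ A))

  -- at A = 0 the truncated A ∸ 1 is 0, which gives the length 1 of s
  reflectionLength : ℕ → ℕ
  reflectionLength A = suc (2 * ((A ∸ 1) ⊓ (n ∸ A)))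

  rotationLength-≤m : ∀ {A} → A ≤ m → rotationLength A ≡ 2 * A
  rotationLength-≤m {A} A≤m = cong (2 *_) (ℕP.m≤n⇒m⊓n≡m (begin
    A       ≤⟨ A≤m ⟩
    m       ≡⟨ n∸m≡m ⟨
    n ∸ m   ≤⟨ ℕP.∸-monoʳ-≤ n A≤m ⟩
    n ∸ A   ∎))
    where open ℕP.≤-Reasoning

  rotationLength-≥m : ∀ {A} → m ≤ A → rotationLength A ≡ 2 * (n ∸ A)
  rotationLength-≥m {A} m≤A = cong (2 *_) (ℕP.m≥n⇒m⊓n≡n (begin
    n ∸ A   ≤⟨ ℕP.∸-monoʳ-≤ n m≤A ⟩
    n ∸ m   ≡⟨ n∸m≡m ⟩
    m       ≤⟨ m≤A ⟩
    A       ∎))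
    where open ℕP.≤-Reasoning

  reflectionLength-≤m : ∀ {A} → A ≤ m → reflectionLength A ≡ suc (2 * (A ∸ 1))
  reflectionLength-≤m {A} A≤m = cong (λ x → suc (2 * x)) (ℕP.m≤n⇒m⊓n≡m (begin
    A ∸ 1   ≤⟨ ℕP.m∸n≤m A 1 ⟩
    A       ≤⟨ A≤m ⟩
    m       ≡⟨ n∸m≡m ⟨
    n ∸ m   ≤⟨ ℕP.∸-monoʳ-≤ n A≤m ⟩
    n ∸ A   ∎))
    where open ℕP.≤-Reasoning

  reflectionLength->m : ∀ {A} → m < A → reflectionLength A ≡ suc (2 * (n ∸ A))
  reflectionLength->m {A} m<A = cong (λ x → suc (2 * x)) (ℕP.m≥n⇒m⊓n≡n (begin
    n ∸ A       ≤⟨ ℕP.∸-monoʳ-≤ n m<A ⟩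
    n ∸ suc m   ≤⟨ ℕP.∸-monoʳ-≤ n (ℕP.n≤1+n m) ⟩
    n ∸ m       ≡⟨ n∸m≡m ⟩
    m           ≤⟨ ℕP.∸-monoˡ-≤ 1 m<A ⟩
    A ∸ 1       ∎))
    where open ℕP.≤-Reasoning

  rotationLength-∸ : ∀ {A} → A ≤ n → rotationLength (n ∸ A) ≡ rotationLength A
  rotationLength-∸ {A} A≤n =
    cong (2 *_) (trans (cong ((n ∸ A) ⊓_) (ℕP.m∸[m∸n]≡n A≤n)) (ℕP.⊓-comm (n ∸ A) A))

  reflectionLength-≤ : ∀ A → reflectionLength A ≤ suc (rotationLength A)
  reflectionLength-≤ A =
    s≤s (ℕP.*-monoʳ-≤ 2 (ℕP.⊓-monoˡ-≤ (n ∸ A) (ℕP.m∸n≤m A 1)))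

  rotationLength-≤ : ∀ A → rotationLength A ≤ suc (reflectionLength A)
  rotationLength-≤ A = begin
    2 * (A ⊓ (n ∸ A))
      ≤⟨ ℕP.*-monoʳ-≤ 2 (ℕP.⊓-mono-≤ (ℕP.m≤n+m∸n A 1) (ℕP.n≤1+n (n ∸ A))) ⟩
    2 * suc ((A ∸ 1) ⊓ (n ∸ A))
      ≡⟨ ℕP.*-suc 2 _ ⟩
    suc (reflectionLength A) ∎
    where open ℕP.≤-Reasoning

  next prev : ℕ → ℕ
  next A = (A + 1) % n
  prev A = (A + (n ∸ 1)) % n

  next-periodic : ∀ (f : ℕ → ℕ) → f 0 ≡ f n → ∀ {A} → A < n → f (next A) ≡ f (suc A)
  next-periodic f f0≡fn {A} A<n with ℕP.m≤n⇒m<n∨m≡n A<n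
  ... | inj₁ 1+A<n = cong f (trans (cong (_% n) (ℕP.+-comm A 1)) (m<n⇒m%n≡m 1+A<n))
  ... | inj₂ 1+A≡n = begin
    f ((A + 1) % n)  ≡⟨ cong (λ x → f (x % n)) (trans (ℕP.+-comm A 1) 1+A≡n) ⟩
    f (n % n)        ≡⟨ cong f (n%n≡0 n) ⟩
    f 0              ≡⟨ f0≡fn ⟩
    f n              ≡⟨ cong f 1+A≡n ⟨
    f (suc A)        ∎
    where open ≡-Reasoning

  prev-zero : prev 0 ≡ n ∸ 1
  prev-zero = m<n⇒m%n≡m (ℕP.∸-monoʳ-< {n} {1} {0} z<s (ℕP.<⇒≤ 1<n))

  prev-suc : ∀ {A} → A < n → prev (suc A) ≡ A
  prev-suc {A} A<n = begin
    (suc A + (n ∸ 1)) % n  ≡⟨ cong (_% n) (trans (sym (ℕP.+-suc A (n ∸ 1))) (cong (A +_) n∸1+1≡n)) ⟩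
    (A + n) % n            ≡⟨ [m+n]%n≡m%n A n ⟩
    A % n                  ≡⟨ m<n⇒m%n≡m A<n ⟩
    A                      ∎
    where
    open ≡-Reasoning
    n∸1+1≡n : suc (n ∸ 1) ≡ n
    n∸1+1≡n = ℕP.m+[n∸m]≡n (ℕP.<⇒≤ 1<n)

  record Lengths (A rot refl rot⁺ refl⁺ rot⁻ : ℕ) : Set where
    field
      rotation    : rotationLength A ≡ rot
      reflection  : reflectionLength A ≡ refl
      rotation⁺   : rotationLength (next A) ≡ rot⁺
      reflection⁺ : reflectionLength (next A) ≡ refl⁺
      rotation⁻   : rotationLength (prev A) ≡ rot⁻

  rotation-next : ∀ {A} → A < n → rotationLength (next A) ≡ rotationLength (suc A)
  rotation-next = next-periodic rotationLength
    (sym (cong (2 *_) (trans (cong (n ⊓_) (ℕP.n∸n≡0 n)) (ℕP.⊓-zeroʳ n))))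

  reflection-next : ∀ {A} → A < n → reflectionLength (next A) ≡ reflectionLength (suc A)
  reflection-next = next-periodic reflectionLength
    (sym (cong (λ x → suc (2 * x)) (trans (cong ((n ∸ 1) ⊓_) (ℕP.n∸n≡0 n)) (ℕP.⊓-zeroʳ (n ∸ 1)))))

  2*-suc : ∀ x → 2 * suc x ≡ 2 + 2 * x
  2*-suc = ℕP.*-suc 2

  lengths-origin : Lengths 0 0 1 2 1 2
  lengths-origin = record
    { rotation    = refl
    ; reflection  = refl
    ; rotation⁺   = trans (rotation-next z<s) (rotationLength-≤m (s≤s z≤n))
    ; reflection⁺ = trans (reflection-next z<s) (reflectionLength-≤m (s≤s z≤n))
    ; rotation⁻   = begin
        rotationLength (prev 0)   ≡⟨ cong rotationLength prev-zero ⟩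
        rotationLength (n ∸ 1)    ≡⟨ rotationLength-∸ (ℕP.<⇒≤ 1<n) ⟩
        rotationLength 1          ≡⟨ rotationLength-≤m (s≤s z≤n) ⟩
        2                         ∎
    }
    where open ≡-Reasoning

  lengths-lower : ∀ {j} → j < k →
                  Lengths (suc j) (2 + 2 * j) (1 + 2 * j) (4 + 2 * j) (3 + 2 * j) (2 * j)
  lengths-lower {j} j<k = record
    { rotation    = trans (rotationLength-≤m 1+j≤m) (2*-suc j)
    ; reflection  = reflectionLength-≤m 1+j≤m
    ; rotation⁺   = trans (rotation-next (≤m⇒<n 1+j≤m)) (trans (rotationLength-≤m (s≤s j<k))
                      (trans (2*-suc (suc j)) (cong (2 +_) (2*-suc j))))
    ; reflection⁺ = trans (reflection-next (≤m⇒<n 1+j≤m))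
                      (trans (reflectionLength-≤m (s≤s j<k)) (cong suc (2*-suc j)))
    ; rotation⁻   = trans (cong rotationLength (prev-suc (ℕP.<-trans (ℕP.n<1+n j) (≤m⇒<n 1+j≤m))))
                      (rotationLength-≤m (ℕP.≤-trans (ℕP.n≤1+n j) 1+j≤m))
    }
    where
    1+j≤m : suc j ≤ m
    1+j≤m = s≤s (ℕP.<⇒≤ j<k)

  lengths-middle : Lengths m (2 + 2 * k) (1 + 2 * k) (2 * k) (1 + 2 * k) (2 * k)
  lengths-middle = record
    { rotation    = trans (rotationLength-≤m ℕP.≤-refl) (2*-suc k)
    ; reflection  = reflectionLength-≤m ℕP.≤-refl
    ; rotation⁺   = trans (rotation-next m<n)
                      (trans (rotationLength-≥m (ℕP.n≤1+n m)) (cong (2 *_) n∸1+m≡k))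
    ; reflection⁺ = trans (reflection-next m<n)
                      (trans (reflectionLength->m (ℕP.n<1+n m)) (cong (λ x → suc (2 * x)) n∸1+m≡k))
    ; rotation⁻   = trans (cong rotationLength (prev-suc (ℕP.<-trans (ℕP.n<1+n k) m<n)))
                      (rotationLength-≤m (ℕP.n≤1+n k))
    }

  lengths-upper : ∀ {A} d → d < k → A + suc d ≡ n →
                  Lengths A (2 + 2 * d) (3 + 2 * d) (2 * d) (1 + 2 * d) (4 + 2 * d)
  lengths-upper {zero} d d<k 0+1+d≡n with () ← m<upper {0} d<k 0+1+d≡n
  lengths-upper {suc A} d d<k A+1+d≡n = record
    { rotation    = trans (rotationLength-≥m (ℕP.<⇒≤ m<1+A)) 2[n∸1+A]≡2+2d
    ; reflection  = trans (reflectionLength->m m<1+A) (cong suc 2[n∸1+A]≡2+2d)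
    ; rotation⁺   = trans (rotation-next 1+A<n)
                      (trans (rotationLength-≥m (ℕP.<⇒≤ m<2+A)) (cong (2 *_) n∸2+A≡d))
    ; reflection⁺ = trans (reflection-next 1+A<n)
                      (trans (reflectionLength->m m<2+A) (cong (λ x → suc (2 * x)) n∸2+A≡d))
    ; rotation⁻   = trans (cong rotationLength (prev-suc (ℕP.<-trans (ℕP.n<1+n A) 1+A<n)))
                      (trans (rotationLength-≥m (ℕP.≤-pred m<1+A))
                        (trans (cong (2 *_) (n∸≡ {A} (trans (ℕP.+-suc A (suc d)) A+1+d≡n)))
                          (trans (2*-suc (suc d)) (cong (2 +_) (2*-suc d)))))
    }
    where
    m<1+A : m < suc A
    m<1+A = m<upper d<k A+1+d≡n
    m<2+A : m < suc (suc A)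
    m<2+A = ℕP.<-trans m<1+A (ℕP.n<1+n _)
    1+A<n : suc A < n
    1+A<n = subst (suc A <_) A+1+d≡n (ℕP.m<m+n (suc A) z<s)
    n∸2+A≡d : n ∸ suc (suc A) ≡ d
    n∸2+A≡d = n∸≡ {suc (suc A)} (trans (sym (ℕP.+-suc (suc A) d)) A+1+d≡n)
    2[n∸1+A]≡2+2d : 2 * (n ∸ suc A) ≡ 2 + 2 * d
    2[n∸1+A]≡2+2d = trans (cong (2 *_) (n∸≡ {suc A} A+1+d≡n)) (2*-suc d)

  -- the descent classes for A₁: {e}, {s}, {w₀}, {w₀s} and X ∋ t, Y ∋ ts, both empty when k = 0
  data Class : Set where
    Ce Cs Cw₀ Cw₀s CX CY : Class

  classOf : ∀ {A} → Region A → Bool → Class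
  classOf origin        false = Ce
  classOf origin        true  = Cs
  classOf (lower _)     false = CY
  classOf (lower _)     true  = CX
  classOf middle        false = Cw₀
  classOf middle        true  = Cw₀s
  classOf (upper _ _ _) false = CX
  classOf (upper _ _ _) true  = CY

  descent-s descent-t descent-sts : Class → Bool
  descent-s Ce   = false
  descent-s Cs   = true
  descent-s Cw₀  = true
  descent-s Cw₀s = false
  descent-s CX   = false
  descent-s CY   = true
  descent-t Ce   = false
  descent-t Cs   = false
  descent-t Cw₀  = true
  descent-t Cw₀s = true
  descent-t CX   = true
  descent-t CY   = false
  descent-sts Ce   = false
  descent-sts Cs   = false
  descent-sts Cw₀  = true
  descent-sts Cw₀s = true
  descent-sts CX   = false
  descent-sts CY   = true

  lengthAt : Bool → ℕ → ℕ
  lengthAt false = rotationLength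
  lengthAt true  = reflectionLength

  -- (ρ^A s^b) t = ρ^(t-exponent b A) s^(not b), and similarly for sts
  t-exponent sts-exponent : Bool → ℕ → ℕ
  t-exponent false = next
  t-exponent true  = prev
  sts-exponent false = prev
  sts-exponent true  = next

  Step : Bool → ℕ → ℕ → Set
  Step true  x y = suc x ≡ y
  Step false x y = x ≡ suc y

  descend : ∀ {x y z} → x ≡ z → y ≡ suc z → Step true x y
  descend x≡z y≡1+z = trans (cong suc x≡z) (sym y≡1+z)

  ascend : ∀ {x y z} → x ≡ suc z → y ≡ z → Step false x y
  ascend x≡1+z y≡z = trans x≡1+z (cong suc (sym y≡z))

  s-step : ∀ {A} (r : Region A) b → Step (descent-s (classOf r b)) (lengthAt (not b) A) (lengthAt b A)
  s-step origin false = refl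
  s-step origin true  = refl
  s-step (lower j<k) false = descend reflection rotation
    where open Lengths (lengths-lower j<k)
  s-step (lower j<k) true  = ascend rotation reflection
    where open Lengths (lengths-lower j<k)
  s-step middle false = descend reflection rotation
    where open Lengths lengths-middle
  s-step middle true  = ascend rotation reflection
    where open Lengths lengths-middle
  s-step (upper d d<k eq) false = ascend reflection rotation
    where open Lengths (lengths-upper d d<k eq)
  s-step (upper d d<k eq) true  = descend rotation reflection
    where open Lengths (lengths-upper d d<k eq)

  t-step : ∀ {A} (r : Region A) b →
           Step (descent-t (classOf r b)) (lengthAt (not b) (t-exponent b A)) (lengthAt b A)
  t-step origin false = ascend reflection⁺ rotation
    where open Lengths lengths-origin
  t-step origin true  = ascend rotation⁻ reflection
    where open Lengths lengths-origin
  t-step (lower j<k) false = ascend reflection⁺ rotation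
    where open Lengths (lengths-lower j<k)
  t-step (lower j<k) true  = descend rotation⁻ reflection
    where open Lengths (lengths-lower j<k)
  t-step middle false = descend reflection⁺ rotation
    where open Lengths lengths-middle
  t-step middle true  = descend rotation⁻ reflection
    where open Lengths lengths-middle
  t-step (upper d d<k eq) false = descend reflection⁺ rotation
    where open Lengths (lengths-upper d d<k eq)
  t-step (upper d d<k eq) true  = ascend rotation⁻ reflection
    where open Lengths (lengths-upper d d<k eq)

  <ᵇ-true : ∀ {x y} → x < y → (x <ᵇ y) ≡ true
  <ᵇ-true x<y = Equivalence.to BoolP.T-≡ (ℕP.<⇒<ᵇ x<y)

  <ᵇ-false : ∀ {x y} → y ≤ x → (x <ᵇ y) ≡ false
  <ᵇ-false {x} {y} y≤x = ¬T⇒≡false (λ x<ᵇy → ℕP.<⇒≱ (ℕP.<ᵇ⇒< x y x<ᵇy) y≤x)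

  sts-descent : ∀ {A} (r : Region A) b →
    (lengthAt (not b) (sts-exponent b A) <ᵇ lengthAt b A) ≡ descent-sts (classOf r b)
  sts-descent origin false = refl
  sts-descent origin true  = cong (_<ᵇ 1) rotation⁺
    where open Lengths lengths-origin
  sts-descent (lower {j} j<k) false = <ᵇ-true (begin-strict
    reflectionLength (prev (suc j))        ≤⟨ reflectionLength-≤ (prev (suc j)) ⟩
    suc (rotationLength (prev (suc j)))    ≡⟨ cong suc rotation⁻ ⟩
    1 + 2 * j                              <⟨ ℕP.n<1+n _ ⟩
    2 + 2 * j                              ≡⟨ rotation ⟨
    rotationLength (suc j)                 ∎)
    where
    open Lengths (lengths-lower j<k)
    open ℕP.≤-Reasoning
  sts-descent (lower {j} j<k) true =
    trans (cong₂ _<ᵇ_ rotation⁺ reflection) (<ᵇ-false (s≤s (ℕP.m≤n+m (2 * j) 3)))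
    where open Lengths (lengths-lower j<k)
  sts-descent middle false = <ᵇ-true (begin-strict
    reflectionLength (prev m)              ≤⟨ reflectionLength-≤ (prev m) ⟩
    suc (rotationLength (prev m))          ≡⟨ cong suc rotation⁻ ⟩
    1 + 2 * k                              <⟨ ℕP.n<1+n _ ⟩
    2 + 2 * k                              ≡⟨ rotation ⟨
    rotationLength m                       ∎)
    where
    open Lengths lengths-middle
    open ℕP.≤-Reasoning
  sts-descent middle true = trans (cong₂ _<ᵇ_ rotation⁺ reflection) (<ᵇ-true (ℕP.n<1+n (2 * k)))
    where open Lengths lengths-middle
  sts-descent {A} (upper d d<k eq) false = <ᵇ-false (ℕP.≤-pred (begin
    suc (rotationLength A)                 ≡⟨ cong suc rotation ⟩
    3 + 2 * d                              ≤⟨ ℕP.n≤1+n _ ⟩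
    4 + 2 * d                              ≡⟨ rotation⁻ ⟨
    rotationLength (prev A)                ≤⟨ rotationLength-≤ (prev A) ⟩
    suc (reflectionLength (prev A))        ∎))
    where
    open Lengths (lengths-upper d d<k eq)
    open ℕP.≤-Reasoning
  sts-descent (upper d d<k eq) true =
    trans (cong₂ _<ᵇ_ rotation⁺ reflection) (<ᵇ-true (ℕP.m<n+m (2 * d) {3} z<s))
    where open Lengths (lengths-upper d d<k eq)

module CoxeterLength (k : ℕ) where
  open Dihedral k
  open DihedralGroup k
  open LengthFormulas k
  open GroupProperties W-group using (\\-leftDividesʳ; ⁻¹-anti-homo-∙; ⁻¹-involutive; ε⁻¹≈ε)
  open import Data.Nat using (_+_; _*_; _∸_; _%_; _<_; _≤_; _<ᵇ_; _⊓_)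

  len : W → ℕ
  len (a , b) = lengthAt b (toℕ a)

  cls : W → Class
  cls (a , b) = classOf (region (FinP.toℕ<n a)) b

  toℕ-1 : toℕ (1 mod n) ≡ 1
  toℕ-1 = trans (toℕ-mod 1) (m<n⇒m%n≡m 1<n)

  toℕ-n∸1 : toℕ ((n ∸ 1) mod n) ≡ n ∸ 1
  toℕ-n∸1 = trans (toℕ-mod (n ∸ 1)) (m<n⇒m%n≡m (ℕP.∸-monoʳ-< {n} {1} {0} z<s (ℕP.<⇒≤ 1<n)))

  ·s≡ : ∀ a b → (a , b) · s ≡ (a , not b)
  ·s≡ a false = cong (_, true) (trans (cong (_mod n) (ℕP.+-identityʳ (toℕ a))) (toℕ-mod-inverse a))
  ·s≡ a true  = cong (_, false) (trans (mod-cong a+n≋a) (toℕ-mod-inverse a))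
    where
    a+n≋a : toℕ a + n ≋ toℕ a
    a+n≋a = ≋-trans (≋-+ (≋-refl {toℕ a}) n≋0) (≡⇒≋ (ℕP.+-identityʳ (toℕ a)))

  sts≡ : s · t · s ≡ ((n ∸ 1) mod n , true)
  sts≡ = cong (_, true) (mod-cong (≋-trans (≡⇒≋ (ℕP.+-identityʳ _))
           (≋-trans (toℕ-mod-≋ (n ∸ toℕ (1 mod n))) (≡⇒≋ (cong (n ∸_) toℕ-1)))))

  len-·s : ∀ a b → len ((a , b) · s) ≡ lengthAt (not b) (toℕ a)
  len-·s a b = cong len (·s≡ a b)

  len-·t : ∀ a b → len ((a , b) · t) ≡ lengthAt (not b) (t-exponent b (toℕ a))
  len-·t a false = cong reflectionLength
    (trans (toℕ-mod (toℕ a + toℕ (1 mod n))) (cong (λ x → (toℕ a + x) % n) toℕ-1))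
  len-·t a true  = cong rotationLength
    (trans (toℕ-mod (toℕ a + (n ∸ toℕ (1 mod n)))) (cong (λ x → (toℕ a + (n ∸ x)) % n) toℕ-1))

  len-·sts : ∀ a b → len ((a , b) · (s · t · s)) ≡ lengthAt (not b) (sts-exponent b (toℕ a))
  len-·sts a b =
    subst (λ r → len ((a , b) · r) ≡ lengthAt (not b) (sts-exponent b (toℕ a))) (sym sts≡) (by b)
    where
    n∸[n∸1]≡1 : n ∸ toℕ ((n ∸ 1) mod n) ≡ 1
    n∸[n∸1]≡1 = trans (cong (n ∸_) toℕ-n∸1) (ℕP.m∸[m∸n]≡n (ℕP.<⇒≤ 1<n))
    by : ∀ b → len ((a , b) · ((n ∸ 1) mod n , true)) ≡ lengthAt (not b) (sts-exponent b (toℕ a))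
    by false = cong reflectionLength
      (trans (toℕ-mod (toℕ a + toℕ ((n ∸ 1) mod n))) (cong (λ x → (toℕ a + x) % n) toℕ-n∸1))
    by true  = cong rotationLength
      (trans (toℕ-mod (toℕ a + (n ∸ toℕ ((n ∸ 1) mod n)))) (cong (λ x → (toℕ a + x) % n) n∸[n∸1]≡1))

  step-s : ∀ u → Step (descent-s (cls u)) (len (u · s)) (len u)
  step-s (a , b) rewrite len-·s a b = s-step (region (FinP.toℕ<n a)) b

  step-t : ∀ u → Step (descent-t (cls u)) (len (u · t)) (len u)
  step-t (a , b) rewrite len-·t a b = t-step (region (FinP.toℕ<n a)) b

  <ᵇ-sts : ∀ u → (len (u · (s · t · s)) <ᵇ len u) ≡ descent-sts (cls u)
  <ᵇ-sts (a , b) rewrite len-·sts a b = sts-descent (region (FinP.toℕ<n a)) b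

  Step-≤ : ∀ b {x y} → Step b x y → x ≤ suc y
  Step-≤ true  refl = ℕP.m≤n⇒m≤1+n (ℕP.n≤1+n _)
  Step-≤ false refl = ℕP.≤-refl

  rotationLength-neg : ∀ A → A < n → rotationLength ((n ∸ A) % n) ≡ rotationLength A
  rotationLength-neg zero    _   = cong rotationLength (n%n≡0 n)
  rotationLength-neg (suc A) A<n =
    trans (cong rotationLength (m<n⇒m%n≡m (ℕP.∸-monoʳ-< {n} {suc A} {0} z<s (ℕP.<⇒≤ A<n))))
          (rotationLength-∸ (ℕP.<⇒≤ A<n))

  len-⁻¹ : ∀ u → len (u ⁻¹) ≡ len u
  len-⁻¹ (a , false) =
    trans (cong rotationLength (toℕ-mod (n ∸ toℕ a))) (rotationLength-neg (toℕ a) (FinP.toℕ<n a))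
  len-⁻¹ (a , true)  = refl

  len-gen· : ∀ g w → len (gen g · w) ≡ len (w ⁻¹ · gen g)
  len-gen· gs w = trans (sym (len-⁻¹ (s · w))) (cong len (⁻¹-anti-homo-∙ s w))
  len-gen· gt w = trans (sym (len-⁻¹ (t · w))) (cong len (⁻¹-anti-homo-∙ t w))

  len-gen·-≤ : ∀ g w → len (gen g · w) ≤ suc (len w)
  len-gen·-≤ g w rewrite len-gen· g w | sym (len-⁻¹ w) = by g
    where
    by : ∀ g → len (w ⁻¹ · gen g) ≤ suc (len (w ⁻¹))
    by gs = Step-≤ _ (step-s (w ⁻¹))
    by gt = Step-≤ _ (step-t (w ⁻¹))

  len-eval : ∀ u → len (eval u) ≤ length u
  len-eval []      = z≤n
  len-eval (g ∷ u) = ℕP.≤-trans (len-gen·-≤ g (eval u)) (s≤s (len-eval u))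

  w₀ : W
  w₀ = (m mod n , false)

  toℕ-m : toℕ (m mod n) ≡ m
  toℕ-m = trans (toℕ-mod m) (m<n⇒m%n≡m m<n)

  data ClassView : W → Class → Set where
    is-e   : ClassView e Ce
    is-s   : ClassView s Cs
    is-w₀  : ClassView w₀ Cw₀
    is-w₀s : ClassView (w₀ · s) Cw₀s
    in-X   : ∀ {u} → 0 < k → ClassView u CX
    in-Y   : ∀ {u} → 0 < k → ClassView u CY

  classView : ∀ u → ClassView u (cls u)
  classView (a , b) = view (region (FinP.toℕ<n a)) b refl
    where
    a≡ : ∀ {A} → toℕ a ≡ A → a ≡ A mod n
    a≡ {A} a≡A = FinP.toℕ-injective
      (trans a≡A (sym (trans (toℕ-mod A) (m<n⇒m%n≡m (subst (_< n) a≡A (FinP.toℕ<n a))))))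
    view : ∀ {A} (r : Region A) b → toℕ a ≡ A → ClassView (a , b) (classOf r b)
    view origin false a≡0 rewrite a≡ a≡0 = is-e
    view origin true  a≡0 rewrite a≡ a≡0 = is-s
    view middle false a≡m rewrite a≡ a≡m = is-w₀
    view middle true  a≡m rewrite a≡ a≡m | sym (·s≡ (m mod n) false) = is-w₀s
    view (lower j<k)     false _ = in-Y (ℕP.≤-<-trans z≤n j<k)
    view (lower j<k)     true  _ = in-X (ℕP.≤-<-trans z≤n j<k)
    view (upper _ d<k _) false _ = in-X (ℕP.≤-<-trans z≤n d<k)
    view (upper _ d<k _) true  _ = in-Y (ℕP.≤-<-trans z≤n d<k)

  right-descent : ∀ v → v ≢ e → ∃ λ g → suc (len (v · gen g)) ≡ len v
  right-descent v v≢e with cls v | classView v | step-s v | step-t v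
  ... | Ce   | is-e   | _  | _  = ⊥-elim (v≢e refl)
  ... | Cs   | is-s   | s↓ | _  = gs , s↓
  ... | Cw₀  | is-w₀  | s↓ | _  = gs , s↓
  ... | CY   | in-Y _ | s↓ | _  = gs , s↓
  ... | Cw₀s | is-w₀s | _  | t↓ = gt , t↓
  ... | CX   | in-X _ | _  | t↓ = gt , t↓

  left-descent : ∀ w → w ≢ e → ∃ λ g → suc (len (gen g · w)) ≡ len w
  left-descent w w≢e with right-descent (w ⁻¹) w⁻¹≢e
    where
    w⁻¹≢e : w ⁻¹ ≢ e
    w⁻¹≢e w⁻¹≡e = w≢e (trans (sym (⁻¹-involutive w)) (trans (cong _⁻¹ w⁻¹≡e) ε⁻¹≈ε))
  ... | g , shorter = g , trans (cong suc (len-gen· g w)) (trans shorter (len-⁻¹ w))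

  gen-involutive : ∀ g w → gen g · (gen g · w) ≡ w
  gen-involutive gs = \\-leftDividesʳ s
  gen-involutive gt = \\-leftDividesʳ t

  reduced-word : ∀ N w → len w ≤ N → ∃ λ u → length u ≡ len w × eval u ≡ w
  reduced-word N w len≤N with w ≟W e
  ... | yes refl = [] , refl , refl
  ... | no w≢e   = extend N (left-descent w w≢e) len≤N
    where
    extend : ∀ N → (∃ λ g → suc (len (gen g · w)) ≡ len w) → len w ≤ N →
             ∃ λ u → length u ≡ len w × eval u ≡ w
    extend zero    (g , shorter) len≤0 = ⊥-elim (ℕP.<⇒≱ (subst (0 <_) shorter z<s) len≤0)
    extend (suc N) (g , shorter) len≤1+N
      with reduced-word N (gen g · w) (ℕP.≤-pred (subst (_≤ suc N) (sym shorter) len≤1+N))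
    ... | u , length≡ , eval≡ =
      g ∷ u , trans (cong suc length≡) shorter , trans (cong (gen g ·_) eval≡) (gen-involutive g w)

  words-complete : ∀ u → u ∈ words (length u)
  words-complete []       = here refl
  words-complete (gs ∷ u) =
    AnyP.concatMap⁺ _ (Any.map (λ { refl → here refl }) (words-complete u))
  words-complete (gt ∷ u) =
    AnyP.concatMap⁺ _ (Any.map (λ { refl → there (here refl) }) (words-complete u))

  words-length : ∀ j → All (λ u → length u ≡ j) (words j)
  words-length zero    = refl ∷ []
  words-length (suc j) = AllP.concat⁺ (AllP.map⁺ (All.map both (words-length j)))
    where
    both : ∀ {u} → length u ≡ j → All (λ v → length v ≡ suc j) ((gs ∷ u) ∷ (gt ∷ u) ∷ [])
    both length≡j = cong suc length≡j ∷ cong suc length≡j ∷ []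

  spells : W → List Gen → Bool
  spells w u = ⌊ eval u ≟W w ⌋

  word-of-length-len : ∀ w → any (spells w) (words (len w)) ≡ true
  word-of-length-len w with reduced-word (len w) w ℕP.≤-refl
  ... | u , length≡ , eval≡ = Equivalence.to BoolP.T-≡ (AnyP.any⁺ (spells w) (Any.map
          (λ { refl → fromWitness eval≡ }) (subst (λ j → u ∈ words j) length≡ (words-complete u))))

  no-shorter-word : ∀ w j → j < len w → any (spells w) (words j) ≡ false
  no-shorter-word w j j<len = ¬T⇒≡false λ hit →
    ℕP.<⇒≱ j<len (All.lookupWith {R = λ _ → len w ≤ j} (λ {u} → bound {u}) (words-length j)
                                 (AnyP.any⁻ (spells w) (words j) hit))
    where
    bound : ∀ {u} → length u ≡ j → T (spells w u) → len w ≤ j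
    bound {u} refl spelled = subst (λ v → len v ≤ length u) (toWitness spelled) (len-eval u)

  search-len : ∀ w fuel j → j ≤ len w → len w < j + fuel → search w fuel j ≡ len w
  search-len w zero j j≤len len<j+0 =
    ⊥-elim (ℕP.<⇒≱ len<j+0 (subst (_≤ len w) (sym (ℕP.+-identityʳ j)) j≤len))
  search-len w (suc fuel) j j≤len len<j+1+fuel with ℕP.m≤n⇒m<n∨m≡n j≤len
  ... | inj₂ refl  rewrite word-of-length-len w = refl
  ... | inj₁ j<len rewrite no-shorter-word w j j<len =
    search-len w fuel (suc j) j<len (subst (len w <_) (ℕP.+-suc j fuel) len<j+1+fuel)

  ⊓-≤m : ∀ x y → x + y ≤ n → x ⊓ y ≤ m
  ⊓-≤m x y x+y≤n = ℕP.≮⇒≥ λ m<x⊓y → ℕP.<⇒≱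
    (ℕP.+-mono-< (ℕP.<-≤-trans m<x⊓y (ℕP.m⊓n≤m x y)) (ℕP.<-≤-trans m<x⊓y (ℕP.m⊓n≤n x y)))
    (subst (x + y ≤_) n≡m+m x+y≤n)

  lengthAt-≤ : ∀ b {A} → A ≤ n → lengthAt b A ≤ suc (2 * m)
  lengthAt-≤ false {A} A≤n =
    ℕP.m≤n⇒m≤1+n (ℕP.*-monoʳ-≤ 2 (⊓-≤m A (n ∸ A) (ℕP.≤-reflexive (ℕP.m+[n∸m]≡n A≤n))))
  lengthAt-≤ true  {A} A≤n = s≤s (ℕP.*-monoʳ-≤ 2 (⊓-≤m (A ∸ 1) (n ∸ A)
    (ℕP.≤-trans (ℕP.+-monoˡ-≤ (n ∸ A) (ℕP.m∸n≤m A 1)) (ℕP.≤-reflexive (ℕP.m+[n∸m]≡n A≤n)))))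

  len<4m : ∀ w → len w < 4 * m
  len<4m (a , b) = ℕP.≤-<-trans (lengthAt-≤ b (ℕP.<⇒≤ (FinP.toℕ<n a))) (begin-strict
    suc (2 * m)     <⟨ ℕP.+-monoˡ-≤ (2 * m) (ℕP.*-monoʳ-≤ 2 (s≤s z≤n)) ⟩
    2 * m + 2 * m   ≡⟨ ℕP.*-distribʳ-+ m 2 2 ⟨
    4 * m           ∎)
    where open ℕP.≤-Reasoning

  ℓ≡len : ∀ w → ℓ w ≡ len w
  ℓ≡len w = search-len w (4 * m) 0 z≤n (len<4m w)

module DescentClasses (k : ℕ) where
  open Dihedral k
  open DihedralGroup k
  open LengthFormulas k
  open CoxeterLength k
  open import Data.Nat using (_+_; _∸_; _%_; _<_; _≤_)

  classOf-unique : ∀ {A A′} → A ≡ A′ → (r : Region A) (r′ : Region A′) → ∀ b →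
                   classOf r b ≡ classOf r′ b
  classOf-unique refl = unique
    where
    lower-upper : ∀ {j d} {C : Set} → j < k → suc j + suc d ≡ n → d < k → C
    lower-upper j<k eq d<k = ⊥-elim (ℕP.<-asym (m<upper d<k eq) (s≤s j<k))
    unique : ∀ {A} (r r′ : Region A) → ∀ b → classOf r b ≡ classOf r′ b
    unique origin           origin           b     = refl
    unique origin           (upper d d<k eq) b     = ⊥-elim (ℕP.n≮0 (m<upper d<k eq))
    unique (lower _)        (lower _)        false = refl
    unique (lower _)        (lower _)        true  = refl
    unique (lower k<k)      middle           b     = ⊥-elim (ℕP.<-irrefl refl k<k)
    unique (lower j<k)      (upper d d<k eq) b     = lower-upper j<k eq d<k
    unique middle           (lower k<k)      b     = ⊥-elim (ℕP.<-irrefl refl k<k)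
    unique middle           middle           b     = refl
    unique middle           (upper d d<k eq) b     = ⊥-elim (ℕP.<-irrefl refl (m<upper d<k eq))
    unique (upper d d<k eq) origin           b     = ⊥-elim (ℕP.n≮0 (m<upper d<k eq))
    unique (upper d d<k eq) (lower j<k)      b     = lower-upper j<k eq d<k
    unique (upper d d<k eq) middle           b     = ⊥-elim (ℕP.<-irrefl refl (m<upper d<k eq))
    unique (upper _ _ _)    (upper _ _ _)    false = refl
    unique (upper _ _ _)    (upper _ _ _)    true  = refl

  class·s s·class w₀·class : Class → Class
  class·s Ce   = Cs
  class·s Cs   = Ce
  class·s Cw₀  = Cw₀s
  class·s Cw₀s = Cw₀
  class·s CX   = CY
  class·s CY   = CX
  s·class Ce   = Cs
  s·class Cs   = Ce
  s·class Cw₀  = Cw₀s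
  s·class Cw₀s = Cw₀
  s·class CX   = CX
  s·class CY   = CY
  w₀·class Ce   = Cw₀
  w₀·class Cs   = Cw₀s
  w₀·class Cw₀  = Ce
  w₀·class Cw₀s = Cs
  w₀·class CX   = CY
  w₀·class CY   = CX

  -- the descent classes for A₂
  merge : Class → Class
  merge Ce   = Ce
  merge Cs   = Ce
  merge Cw₀  = Cw₀
  merge Cw₀s = Cw₀
  merge CX   = CX
  merge CY   = CY

  merge-s·class : ∀ c → merge (s·class c) ≡ merge c
  merge-s·class Ce   = refl
  merge-s·class Cs   = refl
  merge-s·class Cw₀  = refl
  merge-s·class Cw₀s = refl
  merge-s·class CX   = refl
  merge-s·class CY   = refl

  merge-w₀·class : ∀ c → merge (w₀·class c) ≡ w₀·class (merge c)
  merge-w₀·class Ce   = refl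
  merge-w₀·class Cs   = refl
  merge-w₀·class Cw₀  = refl
  merge-w₀·class Cw₀s = refl
  merge-w₀·class CX   = refl
  merge-w₀·class CY   = refl

  classOf-not : ∀ {A} (r : Region A) b → classOf r (not b) ≡ class·s (classOf r b)
  classOf-not origin        false = refl
  classOf-not origin        true  = refl
  classOf-not (lower _)     false = refl
  classOf-not (lower _)     true  = refl
  classOf-not middle        false = refl
  classOf-not middle        true  = refl
  classOf-not (upper _ _ _) false = refl
  classOf-not (upper _ _ _) true  = refl

  mirror : ∀ {j} → j < k → suc j + suc (k ∸ suc j) ≡ m
  mirror {j} j<k = trans (ℕP.+-suc (suc j) _) (cong suc (ℕP.m+[n∸m]≡n j<k))

  mirror-< : ∀ {j} → j < k → k ∸ suc j < k
  mirror-< j<k = ℕP.∸-monoʳ-< {o = 0} z<s j<k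

  classOf-neg : ∀ {A A′} (r : Region A) → A′ ≡ (n ∸ A) % n → (r′ : Region A′) → ∀ b →
                classOf r′ (not b) ≡ s·class (classOf r b)
  classOf-neg origin eq r′ false = classOf-unique (trans eq (n%n≡0 n)) r′ origin true
  classOf-neg origin eq r′ true  = classOf-unique (trans eq (n%n≡0 n)) r′ origin false
  classOf-neg (lower {j} j<k) eq r′ b = trans (classOf-unique eq′ r′ image (not b)) (by b)
    where
    1+j≤n : suc j ≤ n
    1+j≤n = ℕP.<⇒≤ (ℕP.<-trans (s≤s j<k) m<n)
    eq′ = trans eq (m<n⇒m%n≡m (ℕP.∸-monoʳ-< {o = 0} z<s 1+j≤n))
    image = upper j j<k (ℕP.m∸n+n≡m 1+j≤n)
    by : ∀ b → classOf image (not b) ≡ s·class (classOf (lower j<k) b)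
    by false = refl
    by true  = refl
  classOf-neg middle eq r′ false = classOf-unique (trans eq n∸m%n≡m) r′ middle true
    where n∸m%n≡m = trans (cong (_% n) n∸m≡m) (m<n⇒m%n≡m m<n)
  classOf-neg middle eq r′ true  = classOf-unique (trans eq n∸m%n≡m) r′ middle false
    where n∸m%n≡m = trans (cong (_% n) n∸m≡m) (m<n⇒m%n≡m m<n)
  classOf-neg {A} (upper d d<k A+1+d≡n) eq r′ b =
    trans (classOf-unique eq′ r′ (lower d<k) (not b)) (by b)
    where
    eq′ = trans eq (trans (cong (_% n) (n∸≡ {A} A+1+d≡n)) (m<n⇒m%n≡m (ℕP.<-trans (s≤s d<k) m<n)))
    by : ∀ b → classOf (lower d<k) (not b) ≡ s·class (classOf (upper d d<k A+1+d≡n) b)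
    by false = refl
    by true  = refl

  classOf-shift : ∀ {A A′} (r : Region A) → A′ ≡ (m + A) % n → (r′ : Region A′) → ∀ b →
                  classOf r′ b ≡ w₀·class (classOf r b)
  classOf-shift origin eq r′ false = classOf-unique (trans eq m+0%n≡m) r′ middle false
    where m+0%n≡m = trans (cong (_% n) (ℕP.+-identityʳ m)) (m<n⇒m%n≡m m<n)
  classOf-shift origin eq r′ true  = classOf-unique (trans eq m+0%n≡m) r′ middle true
    where m+0%n≡m = trans (cong (_% n) (ℕP.+-identityʳ m)) (m<n⇒m%n≡m m<n)
  classOf-shift (lower {j} j<k) eq r′ b = trans (classOf-unique eq′ r′ image b) (by b)
    where
    sum≡n : m + suc j + suc (k ∸ suc j) ≡ n
    sum≡n = trans (ℕP.+-assoc m (suc j) _) (trans (cong (m +_) (mirror j<k)) (sym n≡m+m))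
    eq′ = trans eq (m<n⇒m%n≡m (subst (m + suc j <_) sum≡n (ℕP.m<m+n _ z<s)))
    image = upper {m + suc j} _ (mirror-< j<k) sum≡n
    by : ∀ b → classOf image b ≡ w₀·class (classOf (lower j<k) b)
    by false = refl
    by true  = refl
  classOf-shift middle eq r′ false = classOf-unique (trans eq m+m%n≡0) r′ origin false
    where m+m%n≡0 = trans (cong (_% n) (sym n≡m+m)) (n%n≡0 n)
  classOf-shift middle eq r′ true  = classOf-unique (trans eq m+m%n≡0) r′ origin true
    where m+m%n≡0 = trans (cong (_% n) (sym n≡m+m)) (n%n≡0 n)
  classOf-shift {A} (upper d d<k A+1+d≡n) eq r′ b =
    trans (classOf-unique eq′ r′ (lower (mirror-< d<k)) b) (by b)
    where
    open ≡-Reasoning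
    j = k ∸ suc d
    A≡m+1+j : A ≡ m + suc j
    A≡m+1+j = ℕP.+-cancelʳ-≡ (suc d) A (m + suc j) (begin
      A + suc d              ≡⟨ A+1+d≡n ⟩
      n                      ≡⟨ n≡m+m ⟩
      m + m                  ≡⟨ cong (m +_) (trans (sym (mirror d<k)) (ℕP.+-comm (suc d) (suc j))) ⟩
      m + (suc j + suc d)    ≡⟨ ℕP.+-assoc m (suc j) (suc d) ⟨
      m + suc j + suc d      ∎)
    eq′ = trans eq (begin
      (m + A) % n            ≡⟨ cong (λ x → (m + x) % n) A≡m+1+j ⟩
      (m + (m + suc j)) % n  ≡⟨ cong (_% n) (ℕP.+-assoc m m (suc j)) ⟨
      (m + m + suc j) % n    ≡⟨ cong (λ x → (x + suc j) % n) n≡m+m ⟨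
      (n + suc j) % n        ≡⟨ cong (_% n) (ℕP.+-comm n (suc j)) ⟩
      (suc j + n) % n        ≡⟨ [m+n]%n≡m%n (suc j) n ⟩
      suc j % n              ≡⟨ m<n⇒m%n≡m (ℕP.<-trans (s≤s (mirror-< d<k)) m<n) ⟩
      suc j                  ∎)
    by : ∀ b → classOf (lower (mirror-< d<k)) b ≡ w₀·class (classOf (upper d d<k A+1+d≡n) b)
    by false = refl
    by true  = refl

  cls-·s : ∀ u → cls (u · s) ≡ class·s (cls u)
  cls-·s (a , b) = trans (cong cls (·s≡ a b)) (classOf-not (region (FinP.toℕ<n a)) b)

  cls-s· : ∀ u → cls (s · u) ≡ s·class (cls u)
  cls-s· (a , b) = classOf-neg (region (FinP.toℕ<n a)) (toℕ-mod (n ∸ toℕ a)) (region _) b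

  cls-w₀· : ∀ u → cls (w₀ · u) ≡ w₀·class (cls u)
  cls-w₀· (a , b) = classOf-shift (region (FinP.toℕ<n a))
    (trans (toℕ-mod (toℕ (m mod n) + toℕ a)) (cong (λ x → (x + toℕ a) % n) toℕ-m)) (region _) b

  cls-w₀ : cls w₀ ≡ Cw₀
  cls-w₀ = classOf-unique toℕ-m (region _) middle false

  cls-w₀s : cls (w₀ · s) ≡ Cw₀s
  cls-w₀s = trans (cls-·s w₀) (cong class·s cls-w₀)

  cls-t : 0 < k → cls t ≡ CX
  cls-t 0<k = classOf-unique toℕ-1 (region _) (lower 0<k) true

  cls-ts : 0 < k → cls (t · s) ≡ CY
  cls-ts 0<k = trans (cls-·s t) (cong class·s (cls-t 0<k))

  w₀-central : ∀ u → w₀ · u ≡ u · w₀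
  w₀-central (a , false) = cong (_, false) (cong (_mod n) (ℕP.+-comm (toℕ (m mod n)) (toℕ a)))
  w₀-central (a , true)  = cong (_, true) (cong (_mod n) (trans (ℕP.+-comm (toℕ (m mod n)) (toℕ a))
    (cong (toℕ a +_) (trans toℕ-m (sym (trans (cong (n ∸_) toℕ-m) n∸m≡m))))))

  w₀⁻¹ : w₀ ⁻¹ ≡ w₀
  w₀⁻¹ = cong (_, false) (trans (cong (λ x → (n ∸ x) mod n) toℕ-m) (cong (_mod n) n∸m≡m))

module DescentSpan (k : ℕ) where
  open Dihedral k
  open DihedralGroup k
  open LengthFormulas k
  open CoxeterLength k
  open import Data.Integer using (_+_; _*_; _-_)

  descents : List W → W → List Bool
  descents A u = map (isDescent u) A

  SameDescents : List W → W → W → Set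
  SameDescents A u v = descents A u ≡ descents A v

  Invariant : (W → W → Set) → ℤW → Set
  Invariant _∼_ x = ∀ u v → u ∼ v → x u ≡ x v

  d-same : ∀ A w {u} → SameDescents A u w → d A w u ≡ 1ℤ
  d-same A w {u} u∼w
    rewrite Equivalence.from (all-agree⇔map≡ (isDescent u) (isDescent w) A) u∼w = refl

  d-other : ∀ A w {u} → ¬ SameDescents A u w → d A w u ≡ 0ℤ
  d-other A w {u} u≁w with sameDescent A u w in eq
  ... | true  = contradiction (Equivalence.to (all-agree⇔map≡ (isDescent u) (isDescent w) A) eq)
                              u≁w
  ... | false = refl

  same? : ∀ A u v → Dec (SameDescents A u v)
  same? A u v = ListP.≡-dec BoolP._≟_ (descents A u) (descents A v)

  d-invariant : ∀ A w → Invariant (SameDescents A) (d A w)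
  d-invariant A w u v u∼v with same? A u w
  ... | yes u∼w = trans (d-same A w {u} u∼w) (sym (d-same A w {v} (trans (sym u∼v) u∼w)))
  ... | no u≁w  =
    trans (d-other A w {u} u≁w) (sym (d-other A w {v} (λ v∼w → u≁w (trans u∼v v∼w))))

  combination : List W → List (ℤ × W) → ℤW
  combination A L u = foldr (λ cw acc → proj₁ cw * d A (proj₂ cw) u + acc) 0ℤ L

  combination-invariant : ∀ A L → Invariant (SameDescents A) (combination A L)
  combination-invariant A []            u v u∼v = refl
  combination-invariant A ((c , w) ∷ L) u v u∼v =
    cong₂ _+_ (cong (c *_) (d-invariant A w u v u∼v)) (combination-invariant A L u v u∼v)

  InDescentAlg⇒invariant : ∀ A {x} → InDescentAlg A x → Invariant (SameDescents A) x
  InDescentAlg⇒invariant A (L , x≈L) u v u∼v =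
    trans (x≈L u) (trans (combination-invariant A L u v u∼v) (sym (x≈L v)))

  -- y − y(r) · d_r vanishes on the class of r: one class is removed per representative
  span : ∀ A reps y → Invariant (SameDescents A) y →
         (∀ u → All (λ r → ¬ SameDescents A u r) reps → y u ≡ 0ℤ) → InDescentAlg A y
  span A []         y _     vanishes = [] , λ u → vanishes u []
  span A (r ∷ reps) y y-inv vanishes =
    let L , y′≈L = span A reps y′ y′-inv y′-vanishes
    in  (y r , r) ∷ L ,
        λ u → trans (sym (split (y r) (y u) (d A r u))) (cong (y r * d A r u +_) (y′≈L u))
    where
    split : ∀ a b c → a * c + (b - a * c) ≡ b
    split = solve 3 (λ a b c → a :* c :+ (b :- a :* c) := b) refl
    y′ : ℤW
    y′ u = y u - y r * d A r u
    y′-inv : Invariant (SameDescents A) y′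
    y′-inv u v u∼v = cong₂ (λ a b → a - y r * b) (y-inv u v u∼v) (d-invariant A r u v u∼v)
    y′-vanishes : ∀ u → All (λ r → ¬ SameDescents A u r) reps → y′ u ≡ 0ℤ
    y′-vanishes u u≁reps with same? A u r
    ... | yes u∼r = begin
      y u - y r * d A r u   ≡⟨ cong₂ (λ a b → a - y r * b) (y-inv u r u∼r) (d-same A r {u} u∼r) ⟩
      y r - y r * 1ℤ        ≡⟨ cong (y r -_) (ℤP.*-identityʳ (y r)) ⟩
      y r - y r             ≡⟨ ℤP.+-inverseʳ (y r) ⟩
      0ℤ                    ∎
      where open ≡-Reasoning
    ... | no u≁r = begin
      y u - y r * d A r u
        ≡⟨ cong₂ (λ a b → a - y r * b) (vanishes u (u≁r ∷ u≁reps)) (d-other A r {u} u≁r) ⟩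
      0ℤ - y r * 0ℤ
        ≡⟨ cong (0ℤ -_) (ℤP.*-zeroʳ (y r)) ⟩
      0ℤ ∎
      where open ≡-Reasoning

  invariant⇒InDescentAlg : ∀ A {x} → Invariant (SameDescents A) x → InDescentAlg A x
  invariant⇒InDescentAlg A {x} x-inv =
    span A elems x x-inv (λ u u≁all → contradiction refl (All.lookup u≁all (elems-complete u)))

module ClassDescents (k : ℕ) where
  open Dihedral k
  open LengthFormulas k
  open CoxeterLength k
  open DescentClasses k
  open DescentSpan k
  open import Data.Nat using (_<ᵇ_)

  Step-<ᵇ : ∀ b {x y} → Step b x y → (x <ᵇ y) ≡ b
  Step-<ᵇ true  {x}     refl = <ᵇ-true (ℕP.n<1+n x)
  Step-<ᵇ false {y = y} refl = <ᵇ-false (ℕP.n≤1+n y)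

  isDescent-s : ∀ u → isDescent u s ≡ descent-s (cls u)
  isDescent-s u =
    trans (cong₂ _<ᵇ_ (ℓ≡len (u · s)) (ℓ≡len u)) (Step-<ᵇ (descent-s (cls u)) (step-s u))

  isDescent-t : ∀ u → isDescent u t ≡ descent-t (cls u)
  isDescent-t u =
    trans (cong₂ _<ᵇ_ (ℓ≡len (u · t)) (ℓ≡len u)) (Step-<ᵇ (descent-t (cls u)) (step-t u))

  isDescent-sts : ∀ u → isDescent u (s · t · s) ≡ descent-sts (cls u)
  isDescent-sts u = trans (cong₂ _<ᵇ_ (ℓ≡len (u · (s · t · s))) (ℓ≡len u)) (<ᵇ-sts u)

  code₁ code₂ : Class → List Bool
  code₁ c = descent-s c ∷ descent-t c ∷ descent-sts c ∷ []
  code₂ c = descent-t c ∷ descent-sts c ∷ []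

  descents-A₁ : ∀ u → descents A₁ u ≡ code₁ (cls u)
  descents-A₁ u =
    cong₂ _∷_ (isDescent-s u) (cong₂ _∷_ (isDescent-t u) (cong₂ _∷_ (isDescent-sts u) refl))

  descents-A₂ : ∀ u → descents A₂ u ≡ code₂ (cls u)
  descents-A₂ u = cong₂ _∷_ (isDescent-t u) (cong₂ _∷_ (isDescent-sts u) refl)

  decode₁ : List Bool → Class
  decode₁ (false ∷ false ∷ false ∷ []) = Ce
  decode₁ (true  ∷ false ∷ false ∷ []) = Cs
  decode₁ (true  ∷ true  ∷ true  ∷ []) = Cw₀
  decode₁ (false ∷ true  ∷ true  ∷ []) = Cw₀s
  decode₁ (false ∷ true  ∷ false ∷ []) = CX
  decode₁ _                            = CY

  decode₁-code₁ : ∀ c → decode₁ (code₁ c) ≡ c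
  decode₁-code₁ Ce   = refl
  decode₁-code₁ Cs   = refl
  decode₁-code₁ Cw₀  = refl
  decode₁-code₁ Cw₀s = refl
  decode₁-code₁ CX   = refl
  decode₁-code₁ CY   = refl

  decode₂ : List Bool → Class
  decode₂ (false ∷ false ∷ []) = Ce
  decode₂ (true  ∷ true  ∷ []) = Cw₀
  decode₂ (true  ∷ false ∷ []) = CX
  decode₂ _                    = CY

  decode₂-code₂ : ∀ c → decode₂ (code₂ c) ≡ merge c
  decode₂-code₂ Ce   = refl
  decode₂-code₂ Cs   = refl
  decode₂-code₂ Cw₀  = refl
  decode₂-code₂ Cw₀s = refl
  decode₂-code₂ CX   = refl
  decode₂-code₂ CY   = refl

  code₂-merge : ∀ c → code₂ (merge c) ≡ code₂ c
  code₂-merge Ce   = refl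
  code₂-merge Cs   = refl
  code₂-merge Cw₀  = refl
  code₂-merge Cw₀s = refl
  code₂-merge CX   = refl
  code₂-merge CY   = refl

  same-A₁⇔ : ∀ u v → SameDescents A₁ u v ⇔ cls u ≡ cls v
  same-A₁⇔ u v = mk⇔
    (λ same → begin
      cls u                        ≡⟨ decode₁-code₁ (cls u) ⟨
      decode₁ (code₁ (cls u))      ≡⟨ cong decode₁ (descents-A₁ u) ⟨
      decode₁ (descents A₁ u)      ≡⟨ cong decode₁ same ⟩
      decode₁ (descents A₁ v)      ≡⟨ cong decode₁ (descents-A₁ v) ⟩
      decode₁ (code₁ (cls v))      ≡⟨ decode₁-code₁ (cls v) ⟩
      cls v                        ∎)
    (λ cls≡ → trans (descents-A₁ u) (trans (cong code₁ cls≡) (sym (descents-A₁ v))))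
    where open ≡-Reasoning

  same-A₂⇔ : ∀ u v → SameDescents A₂ u v ⇔ merge (cls u) ≡ merge (cls v)
  same-A₂⇔ u v = mk⇔
    (λ same → begin
      merge (cls u)                ≡⟨ decode₂-code₂ (cls u) ⟨
      decode₂ (code₂ (cls u))      ≡⟨ cong decode₂ (descents-A₂ u) ⟨
      decode₂ (descents A₂ u)      ≡⟨ cong decode₂ same ⟩
      decode₂ (descents A₂ v)      ≡⟨ cong decode₂ (descents-A₂ v) ⟩
      decode₂ (code₂ (cls v))      ≡⟨ decode₂-code₂ (cls v) ⟩
      merge (cls v)                ∎)
    (λ merged → begin
      descents A₂ u                ≡⟨ descents-A₂ u ⟩
      code₂ (cls u)                ≡⟨ code₂-merge (cls u) ⟨
      code₂ (merge (cls u))        ≡⟨ cong code₂ merged ⟩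
      code₂ (merge (cls v))        ≡⟨ code₂-merge (cls v) ⟩
      code₂ (cls v)                ≡⟨ descents-A₂ v ⟨
      descents A₂ v                ∎)
    where open ≡-Reasoning

module DescentAlgebra (k : ℕ) where
  open Dihedral k
  open DihedralGroup k
  open LengthFormulas k
  open CoxeterLength k
  open DescentClasses k
  open DescentSpan k
  open ClassDescents k
  open GroupAlgebra ·-isGroup _≟W_ elems-unique elems-complete
  open GroupProperties W-group using (//-rightDividesʳ; ε⁻¹≈ε)
  open import Data.Integer using (_+_; _*_; _-_)
  open import Data.Nat using (_<_)

  ClassInvariant : ℤW → Set
  ClassInvariant = Invariant (λ u v → cls u ≡ cls v)

  δ-apart : ∀ g v {c c′} → cls g ≡ c → cls v ≡ c′ → c ≢ c′ → δ g v ≡ 0ℤ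
  δ-apart g v cls-g cls-v c≢c′ =
    δ-off (λ g≡v → c≢c′ (trans (sym cls-g) (trans (cong cls g≡v) cls-v)))

  liftBy : Class → W → W
  liftBy Ce   _ = s
  liftBy Cs   v = v
  liftBy Cw₀  _ = w₀ · s
  liftBy Cw₀s v = v
  liftBy CX   v = v
  liftBy CY   v = v

  liftClass : Class → Class
  liftClass Ce  = Cs
  liftClass Cw₀ = Cw₀s
  liftClass c   = c

  cls-liftBy : ∀ v → cls (liftBy (cls v) v) ≡ liftClass (merge (cls v))
  cls-liftBy v with cls v in eq | classView v
  ... | Ce   | is-e   = refl
  ... | Cs   | is-s   = refl
  ... | Cw₀  | is-w₀  = cls-w₀s
  ... | Cw₀s | is-w₀s = cls-w₀s
  ... | CX   | in-X _ = eq
  ... | CY   | in-Y _ = eq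

  module Convolution {x y : ℤW} (x-inv : ClassInvariant x) (y-inv : ClassInvariant y) where

    p q : ℤ
    p = y e - y s
    q = y w₀ - y (w₀ · s)

    -- y with its values at e and w₀ replaced by those at s and w₀s
    y₂ : ℤW
    y₂ v = y v - p * δ e v - q * δ w₀ v

    y-split : ∀ v → y v ≡ y₂ v + p * δ e v + q * δ w₀ v
    y-split v = solve 5 (λ a p q c d → a := a :- p :* c :- q :* d :+ p :* c :+ q :* d) refl
      (y v) p q (δ e v) (δ w₀ v)

    y₂-unchanged : ∀ v {c} → cls v ≡ c → Ce ≢ c → Cw₀ ≢ c → y₂ v ≡ y v
    y₂-unchanged v cls-v Ce≢c Cw₀≢c =
      trans (cong₂ (λ a b → y v - p * a - q * b)
                   (δ-apart e v refl cls-v Ce≢c) (δ-apart w₀ v cls-w₀ cls-v Cw₀≢c))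
            (solve 3 (λ a p q → a :- p :* con 0ℤ :- q :* con 0ℤ := a) refl (y v) p q)

    y₂-lift : ∀ v → y₂ v ≡ y (liftBy (cls v) v)
    y₂-lift v with cls v in eq | classView v
    ... | Ce | is-e = begin
      y e - p * δ e e - q * δ w₀ e
        ≡⟨ cong₂ (λ a b → y e - p * a - q * b) (δ-diag e) (δ-apart w₀ e cls-w₀ refl (λ ())) ⟩
      y e - p * 1ℤ - q * 0ℤ
        ≡⟨ solve 3 (λ a b q → a :- (a :- b) :* con 1ℤ :- q :* con 0ℤ := b) refl (y e) (y s) q ⟩
      y s ∎
      where open ≡-Reasoning
    ... | Cw₀ | is-w₀ = begin
      y w₀ - p * δ e w₀ - q * δ w₀ w₀
        ≡⟨ cong₂ (λ a b → y w₀ - p * a - q * b) (δ-apart e w₀ refl cls-w₀ (λ ())) (δ-diag w₀) ⟩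
      y w₀ - p * 0ℤ - q * 1ℤ
        ≡⟨ solve 3 (λ a b p → a :- p :* con 0ℤ :- (a :- b) :* con 1ℤ := b) refl (y w₀) (y (w₀ · s)) p ⟩
      y (w₀ · s) ∎
      where open ≡-Reasoning
    ... | Cs   | is-s   = y₂-unchanged s eq (λ ()) (λ ())
    ... | Cw₀s | is-w₀s = y₂-unchanged (w₀ · s) eq (λ ()) (λ ())
    ... | CX   | in-X _ = y₂-unchanged v eq (λ ()) (λ ())
    ... | CY   | in-Y _ = y₂-unchanged v eq (λ ()) (λ ())

    y₂-merged : ∀ u v → merge (cls u) ≡ merge (cls v) → y₂ u ≡ y₂ v
    y₂-merged u v merged = begin
      y₂ u                     ≡⟨ y₂-lift u ⟩
      y (liftBy (cls u) u)     ≡⟨ y-inv _ _ lifted-classes ⟩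
      y (liftBy (cls v) v)     ≡⟨ y₂-lift v ⟨
      y₂ v                     ∎
      where
      open ≡-Reasoning
      lifted-classes : cls (liftBy (cls u) u) ≡ cls (liftBy (cls v) v)
      lifted-classes = trans (cls-liftBy u) (trans (cong liftClass merged) (sym (cls-liftBy v)))

    y₂-s· : ∀ v → y₂ (s · v) ≡ y₂ v
    y₂-s· v = y₂-merged (s · v) v (trans (cong merge (cls-s· v)) (merge-s·class (cls v)))

    H : ℤW
    H v = x v + x (v · s)

    C D₀ Dₘ : ℤ
    C  = H t
    D₀ = H e - C
    Dₘ = H w₀ - C

    poles₀ polesₘ : ℤW
    poles₀ v = δ e v + δ (e · s) v
    polesₘ v = δ w₀ v + δ (w₀ · s) v

    H-s : H s ≡ H e
    H-s = begin
      x s + x (s · s)   ≡⟨ cong (λ g → x s + x g) (·-inverseˡ s) ⟩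
      x s + x e         ≡⟨ ℤP.+-comm (x s) (x e) ⟩
      x e + x s         ≡⟨ cong (λ g → x e + x g) (·-identityˡ s) ⟨
      x e + x (e · s)   ∎
      where open ≡-Reasoning

    H-w₀s : H (w₀ · s) ≡ H w₀
    H-w₀s = begin
      x (w₀ · s) + x (w₀ · s · s)   ≡⟨ cong (λ g → x (w₀ · s) + x g) (//-rightDividesʳ s w₀) ⟩
      x (w₀ · s) + x w₀             ≡⟨ ℤP.+-comm (x (w₀ · s)) (x w₀) ⟩
      x w₀ + x (w₀ · s)             ∎
      where open ≡-Reasoning

    H-X : ∀ v → 0 < k → cls v ≡ CX → H v ≡ C
    H-X v 0<k v∈X = cong₂ _+_ (x-inv v t (trans v∈X (sym (cls-t 0<k))))
      (x-inv (v · s) (t · s) (trans (cls-·s v) (trans (cong class·s v∈X) (sym (cls-ts 0<k)))))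

    H-Y : ∀ v → 0 < k → cls v ≡ CY → H v ≡ C
    H-Y v 0<k v∈Y = trans (cong₂ _+_ (x-inv v (t · s) (trans v∈Y (sym (cls-ts 0<k))))
      (x-inv (v · s) t (trans (cls-·s v) (trans (cong class·s v∈Y) (sym (cls-t 0<k))))))
      (ℤP.+-comm (x (t · s)) (x t))

    at : ∀ {v a b} → poles₀ v ≡ a → polesₘ v ≡ b → H v ≡ C + D₀ * a + Dₘ * b →
         H v ≡ C + D₀ * poles₀ v + Dₘ * polesₘ v
    at p₀ pₘ Hv≡ = trans Hv≡ (cong₂ (λ a b → C + D₀ * a + Dₘ * b) (sym p₀) (sym pₘ))

    pole₀ : ∀ {h} → h ≡ H e → h ≡ C + D₀ * 1ℤ + Dₘ * 0ℤ
    pole₀ refl = solve 3 (λ h C D → h := C :+ (h :- C) :* con 1ℤ :+ D :* con 0ℤ) refl (H e) C Dₘ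

    poleₘ : ∀ {h} → h ≡ H w₀ → h ≡ C + D₀ * 0ℤ + Dₘ * 1ℤ
    poleₘ refl = solve 3 (λ h C D → h := C :+ D :* con 0ℤ :+ (h :- C) :* con 1ℤ) refl (H w₀) C D₀

    off-poles : ∀ {h} → h ≡ C → h ≡ C + D₀ * 0ℤ + Dₘ * 0ℤ
    off-poles refl = solve 3 (λ C D D′ → C := C :+ D :* con 0ℤ :+ D′ :* con 0ℤ) refl C D₀ Dₘ

    H-decomposition : ∀ v → H v ≡ C + D₀ * poles₀ v + Dₘ * polesₘ v
    H-decomposition v with cls v in eq | classView v
    ... | Ce | is-e = at
      (cong₂ _+_ (δ-diag e) (δ-apart (e · s) e (cls-·s e) refl (λ ())))
      (cong₂ _+_ (δ-apart w₀ e cls-w₀ refl (λ ())) (δ-apart (w₀ · s) e cls-w₀s refl (λ ())))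
      (pole₀ refl)
    ... | Cs | is-s = at
      (cong₂ _+_ (δ-apart e s refl refl (λ ())) (trans (cong (λ g → δ g s) (·-identityˡ s)) (δ-diag s)))
      (cong₂ _+_ (δ-apart w₀ s cls-w₀ refl (λ ())) (δ-apart (w₀ · s) s cls-w₀s refl (λ ())))
      (pole₀ H-s)
    ... | Cw₀ | is-w₀ = at
      (cong₂ _+_ (δ-apart e w₀ refl cls-w₀ (λ ())) (δ-apart (e · s) w₀ (cls-·s e) cls-w₀ (λ ())))
      (cong₂ _+_ (δ-diag w₀) (δ-apart (w₀ · s) w₀ cls-w₀s cls-w₀ (λ ())))
      (poleₘ refl)
    ... | Cw₀s | is-w₀s = at
      (cong₂ _+_ (δ-apart e (w₀ · s) refl cls-w₀s (λ ()))
                 (δ-apart (e · s) (w₀ · s) (cls-·s e) cls-w₀s (λ ())))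
      (cong₂ _+_ (δ-apart w₀ (w₀ · s) cls-w₀ cls-w₀s (λ ())) (δ-diag (w₀ · s)))
      (poleₘ H-w₀s)
    ... | CX | in-X 0<k = at
      (cong₂ _+_ (δ-apart e v refl eq (λ ())) (δ-apart (e · s) v (cls-·s e) eq (λ ())))
      (cong₂ _+_ (δ-apart w₀ v cls-w₀ eq (λ ())) (δ-apart (w₀ · s) v cls-w₀s eq (λ ())))
      (off-poles (H-X v 0<k eq))
    ... | CY | in-Y 0<k = at
      (cong₂ _+_ (δ-apart e v refl eq (λ ())) (δ-apart (e · s) v (cls-·s e) eq (λ ())))
      (cong₂ _+_ (δ-apart w₀ v cls-w₀ eq (λ ())) (δ-apart (w₀ · s) v cls-w₀s eq (λ ())))
      (off-poles (H-Y v 0<k eq))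

    e\\ : ∀ u → e \\ u ≡ u
    e\\ u = trans (cong (_· u) ε⁻¹≈ε) (·-identityˡ u)

    //e : ∀ u → u // e ≡ u
    //e u = trans (cong (u ·_) ε⁻¹≈ε) (·-identityʳ u)

    ⋆-y : ∀ u → (x ⋆ y) u ≡ (x ⋆ y₂) u + p * x u + q * x (u · w₀)
    ⋆-y u = begin
      (x ⋆ y) u
        ≡⟨ ⋆-congʳ x y-split u ⟩
      (x ⋆ (λ v → y₂ v + p * δ e v + q * δ w₀ v)) u
        ≡⟨ ⋆-distribˡ-+ x (λ v → y₂ v + p * δ e v) (λ v → q * δ w₀ v) u ⟩
      (x ⋆ (λ v → y₂ v + p * δ e v)) u + (x ⋆ (λ v → q * δ w₀ v)) u
        ≡⟨ cong₂ _+_ (⋆-distribˡ-+ x y₂ (λ v → p * δ e v) u) (⋆-*ʳ q x (δ w₀) u) ⟩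
      (x ⋆ y₂) u + (x ⋆ (λ v → p * δ e v)) u + q * (x ⋆ δ w₀) u
        ≡⟨ cong₂ (λ a b → (x ⋆ y₂) u + a + q * b) (⋆-*ʳ p x (δ e) u) (⋆-δʳ x w₀ u) ⟩
      (x ⋆ y₂) u + p * (x ⋆ δ e) u + q * x (u // w₀)
        ≡⟨ cong₂ (λ a b → (x ⋆ y₂) u + p * a + q * x b)
                 (trans (⋆-δʳ x e u) (cong x (//e u))) (cong (u ·_) w₀⁻¹) ⟩
      (x ⋆ y₂) u + p * x u + q * x (u · w₀)
        ∎
      where open ≡-Reasoning

    twice-⋆-y₂ : ∀ u → ℤ.+ 2 * (x ⋆ y₂) u ≡ (H ⋆ y₂) u
    twice-⋆-y₂ u = begin
      ℤ.+ 2 * (x ⋆ y₂) u                          ≡⟨ twice ((x ⋆ y₂) u) ⟩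
      (x ⋆ y₂) u + (x ⋆ y₂) u                     ≡⟨ cong ((x ⋆ y₂) u +_) (⋆-shift x s y₂-s· u) ⟩
      (x ⋆ y₂) u + ((λ v → x (v · s)) ⋆ y₂) u     ≡⟨ ⋆-distribʳ-+ x (λ v → x (v · s)) y₂ u ⟨
      (H ⋆ y₂) u                                  ∎
      where open ≡-Reasoning

    H⋆y₂ : ∀ u → (H ⋆ y₂) u ≡ C * ∑ y₂ + D₀ * (ℤ.+ 2 * y₂ u) + Dₘ * (ℤ.+ 2 * y₂ (w₀ · u))
    H⋆y₂ u = begin
      (H ⋆ y₂) u
        ≡⟨ ⋆-congˡ y₂ H-decomposition u ⟩
      ((λ v → C + D₀ * poles₀ v + Dₘ * polesₘ v) ⋆ y₂) u
        ≡⟨ ⋆-distribʳ-+ (λ v → C + D₀ * poles₀ v) (λ v → Dₘ * polesₘ v) y₂ u ⟩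
      ((λ v → C + D₀ * poles₀ v) ⋆ y₂) u + ((λ v → Dₘ * polesₘ v) ⋆ y₂) u
        ≡⟨ cong₂ _+_ (⋆-distribʳ-+ (λ _ → C) (λ v → D₀ * poles₀ v) y₂ u) (⋆-*ˡ Dₘ polesₘ y₂ u) ⟩
      ((λ _ → C) ⋆ y₂) u + ((λ v → D₀ * poles₀ v) ⋆ y₂) u + Dₘ * (polesₘ ⋆ y₂) u
        ≡⟨ cong₂ (λ a b → a + b + Dₘ * (polesₘ ⋆ y₂) u) (⋆-constˡ C y₂ u) (⋆-*ˡ D₀ poles₀ y₂ u) ⟩
      C * ∑ y₂ + D₀ * (poles₀ ⋆ y₂) u + Dₘ * (polesₘ ⋆ y₂) u
        ≡⟨ cong₂ (λ a b → C * ∑ y₂ + D₀ * a + Dₘ * b) (⋆-δ-pair e s y₂-s· u) (⋆-δ-pair w₀ s y₂-s· u) ⟩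
      C * ∑ y₂ + D₀ * (ℤ.+ 2 * y₂ (e \\ u)) + Dₘ * (ℤ.+ 2 * y₂ (w₀ \\ u))
        ≡⟨ cong₂ (λ a b → C * ∑ y₂ + D₀ * (ℤ.+ 2 * y₂ a) + Dₘ * (ℤ.+ 2 * y₂ b))
                 (e\\ u) (cong (_· u) w₀⁻¹) ⟩
      C * ∑ y₂ + D₀ * (ℤ.+ 2 * y₂ u) + Dₘ * (ℤ.+ 2 * y₂ (w₀ · u))
        ∎
      where open ≡-Reasoning

    Φ : W → ℤ
    Φ u = C * ∑ y₂ + D₀ * (ℤ.+ 2 * y₂ u) + Dₘ * (ℤ.+ 2 * y₂ (w₀ · u))
        + ℤ.+ 2 * (p * x u + q * x (u · w₀))

    twice-⋆ : ∀ u → ℤ.+ 2 * (x ⋆ y) u ≡ Φ u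
    twice-⋆ u = begin
      ℤ.+ 2 * (x ⋆ y) u
        ≡⟨ cong (ℤ.+ 2 *_) (⋆-y u) ⟩
      ℤ.+ 2 * ((x ⋆ y₂) u + p * x u + q * x (u · w₀))
        ≡⟨ cong (ℤ.+ 2 *_) (ℤP.+-assoc ((x ⋆ y₂) u) (p * x u) (q * x (u · w₀))) ⟩
      ℤ.+ 2 * ((x ⋆ y₂) u + (p * x u + q * x (u · w₀)))
        ≡⟨ ℤP.*-distribˡ-+ (ℤ.+ 2) ((x ⋆ y₂) u) (p * x u + q * x (u · w₀)) ⟩
      ℤ.+ 2 * (x ⋆ y₂) u + ℤ.+ 2 * (p * x u + q * x (u · w₀))
        ≡⟨ cong (_+ ℤ.+ 2 * (p * x u + q * x (u · w₀))) (trans (twice-⋆-y₂ u) (H⋆y₂ u)) ⟩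
      Φ u
        ∎
      where open ≡-Reasoning

  -- the relations u ∼⟨ κ ⟩ v for which convolution preserves invariance; κ = id gives the
  -- descent classes of A₁ and κ = merge those of A₂
  record Coarsening (κ : Class → Class) : Set where
    field
      refines-merge : ∀ {c c′} → κ c ≡ κ c′ → merge c ≡ merge c′
      respects-w₀·  : ∀ {c c′} → κ c ≡ κ c′ → κ (w₀·class c) ≡ κ (w₀·class c′)

  _∼⟨_⟩_ : W → (Class → Class) → W → Set
  u ∼⟨ κ ⟩ v = κ (cls u) ≡ κ (cls v)

  cls-·w₀ : ∀ u → cls (u · w₀) ≡ w₀·class (cls u)
  cls-·w₀ u = trans (cong cls (sym (w₀-central u))) (cls-w₀· u)

  ⋆-invariant : ∀ κ → Coarsening κ → ∀ {x y} →
    Invariant _∼⟨ κ ⟩_ x → Invariant _∼⟨ κ ⟩_ y → Invariant _∼⟨ κ ⟩_ (x ⋆ y)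
  ⋆-invariant κ coarse {x} {y} x-inv y-inv u v u∼v =
    ℤP.*-cancelˡ-≡ (ℤ.+ 2) ((x ⋆ y) u) ((x ⋆ y) v) (trans (twice-⋆ u) (trans Φu≡Φv (sym (twice-⋆ v))))
    where
    open Coarsening coarse
    open Convolution (λ u v cls≡ → x-inv u v (cong κ cls≡)) (λ u v cls≡ → y-inv u v (cong κ cls≡))
    merged : merge (cls u) ≡ merge (cls v)
    merged = refines-merge u∼v
    w₀·merged : merge (cls (w₀ · u)) ≡ merge (cls (w₀ · v))
    w₀·merged = begin
      merge (cls (w₀ · u))          ≡⟨ cong merge (cls-w₀· u) ⟩
      merge (w₀·class (cls u))      ≡⟨ merge-w₀·class (cls u) ⟩
      w₀·class (merge (cls u))      ≡⟨ cong w₀·class merged ⟩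
      w₀·class (merge (cls v))      ≡⟨ merge-w₀·class (cls v) ⟨
      merge (w₀·class (cls v))      ≡⟨ cong merge (cls-w₀· v) ⟨
      merge (cls (w₀ · v))          ∎
      where open ≡-Reasoning
    ·w₀-related : (u · w₀) ∼⟨ κ ⟩ (v · w₀)
    ·w₀-related = trans (cong κ (cls-·w₀ u)) (trans (respects-w₀· u∼v) (sym (cong κ (cls-·w₀ v))))
    Φu≡Φv : Φ u ≡ Φ v
    Φu≡Φv = cong₂ (λ (a , b) (c , d) → C * ∑ y₂ + D₀ * (ℤ.+ 2 * a) + Dₘ * (ℤ.+ 2 * b)
                                      + ℤ.+ 2 * (p * c + q * d))
      (cong₂ _,_ (y₂-merged u v merged) (y₂-merged (w₀ · u) (w₀ · v) w₀·merged))
      (cong₂ _,_ (x-inv u v u∼v) (x-inv (u · w₀) (v · w₀) ·w₀-related))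

  *W≗⋆ : ∀ x y u → (x *W y) u ≡ (x ⋆ y) u
  *W≗⋆ x y u = foldr≡sumBy (λ v → x v * y (v ⁻¹ · u)) elems

  subalgebra : ∀ A κ → Coarsening κ → (∀ u v → SameDescents A u v ⇔ u ∼⟨ κ ⟩ v) → IsSubalgebra A
  subalgebra A κ coarse same⇔∼ x y x∈𝒟 y∈𝒟 = invariant⇒InDescentAlg A xy-invariant
    where
    invariant∼ : ∀ {z} → InDescentAlg A z → Invariant _∼⟨ κ ⟩_ z
    invariant∼ z∈𝒟 u v u∼v = InDescentAlg⇒invariant A z∈𝒟 u v (Equivalence.from (same⇔∼ u v) u∼v)
    xy-invariant : Invariant (SameDescents A) (x *W y)
    xy-invariant u v same = begin
      (x *W y) u   ≡⟨ *W≗⋆ x y u ⟩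
      (x ⋆ y) u    ≡⟨ ⋆-invariant κ coarse (invariant∼ x∈𝒟) (invariant∼ y∈𝒟) u v
                                      (Equivalence.to (same⇔∼ u v) same) ⟩
      (x ⋆ y) v    ≡⟨ *W≗⋆ x y v ⟨
      (x *W y) v   ∎
      where open ≡-Reasoning

  id-coarsening : Coarsening id
  id-coarsening = record { refines-merge = cong merge ; respects-w₀· = cong w₀·class }

  merge-coarsening : Coarsening merge
  merge-coarsening = record
    { refines-merge = id
    ; respects-w₀·  = λ {c} {c′} merged →
        trans (merge-w₀·class c) (trans (cong w₀·class merged) (sym (merge-w₀·class c′)))
    }

  A₁-subalgebra : IsSubalgebra A₁
  A₁-subalgebra = subalgebra A₁ id id-coarsening same-A₁⇔

  A₂-subalgebra : IsSubalgebra A₂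
  A₂-subalgebra = subalgebra A₂ merge merge-coarsening same-A₂⇔

theoremB : (k : ℕ) → (A : List (Dihedral.W k)) →
    (A ≡ Dihedral.A₁ k) ⊎ (A ≡ Dihedral.A₂ k) → Dihedral.IsSubalgebra k A
theoremB k A (inj₁ refl) = DescentAlgebra.A₁-subalgebra k
theoremB k A (inj₂ refl) = DescentAlgebra.A₂-subalgebra k
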